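{- Let $(K,R)$ be $(\mathbb{Q},\mathbb{Z})$ or $(\mathbb{Q}(i),\mathbb{Z}[i])$, and let $A_0=(a_1|\dots|a_k)\in R^{n\times k}$ be a $k$-icube of norm $\lambda$. Then: (1) the $R$-module $\Lambda=\{w\in R^n\mid a_j^*w=0\ \text{for }1\leq j\leq k\}$ is free of rank $n-k$; (2) if $Q$ is the restriction of the standard inner product $(v,w)\mapsto v^*w$ to $\Lambda$, then $\mathrm{disc}(Q)=\lambda^k/|d_k(A_0)|^2$.
   Context: $v^*=\overline{v}^T$. A $k$-icube in $R^n$ of norm $\lambda>0$ is $(v_1|\dots|v_k)\in R^{n\times k}$ with $v_i^*v_j=\lambda$ if $i=j$ and $0$ otherwise. $\mathrm{disc}(Q)$ is the determinant of the Gram matrix of $Q$ with respect to a free basis of $\Lambda$. $d_k(A_0)$ is the $k$-th determinantal divisor of $A_0$: a greatest common divisor in $R$ of all $k\times k$ minors of $A_0$ (defined up to units). -}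

module Defs where

open import Data.Nat using (ℕ; zero; suc; _∸_)
open import Data.Integer as ℤ using (ℤ; +_)
open import Data.Fin as Fin using (Fin; zero; suc; punchIn; toℕ)
open import Data.Product using (Σ; ∃; _×_; _,_)
open import Relation.Binary.PropositionalEquality using (_≡_; _≢_)

record GaussInt : Set where
  constructor _+i_
  field
    re : ℤ
    im : ℤ

open GaussInt public

-- The two cases (K,R) = (ℚ,ℤ) or (ℚ(i),ℤ[i]); only R matters.

data Case : Set where
  rationals gaussian : Case

R : Case → Set
R rationals = ℤ
R gaussian  = GaussInt

infixl 6 _+R_ _-R_
infixl 7 _*R_

_+R_ : ∀ {c} → R c → R c → R c
_+R_ {rationals} x y = x ℤ.+ y
_+R_ {gaussian} (a +i b) (c +i d) = (a ℤ.+ c) +i (b ℤ.+ d)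

-R_ : ∀ {c} → R c → R c
-R_ {rationals} x = ℤ.- x
-R_ {gaussian} (a +i b) = (ℤ.- a) +i (ℤ.- b)

_-R_ : ∀ {c} → R c → R c → R c
x -R y = x +R (-R y)

_*R_ : ∀ {c} → R c → R c → R c
_*R_ {rationals} x y = x ℤ.* y
_*R_ {gaussian} (a +i b) (c +i d) =
  ((a ℤ.* c) ℤ.- (b ℤ.* d)) +i ((a ℤ.* d) ℤ.+ (b ℤ.* c))

ι : ∀ {c} → ℤ → R c
ι {rationals} x = x
ι {gaussian} x = x +i (+ 0)

0R 1R : ∀ {c} → R c
0R = ι (+ 0)
1R = ι (+ 1)

conj : ∀ {c} → R c → R c
conj {rationals} x = x
conj {gaussian} (a +i b) = a +i (ℤ.- b)

absSq : ∀ {c} → R c → R c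
absSq x = conj x *R x

Vector : Case → ℕ → Set
Vector c n = Fin n → R c

Matrix : Case → ℕ → ℕ → Set
Matrix c m n = Fin m → Fin n → R c

Σ[_] : ∀ {c} n → (Fin n → R c) → R c
Σ[ zero ] f = 0R
Σ[ suc n ] f = f zero +R Σ[ n ] (λ i → f (suc i))

_∙_ : ∀ {c n} → Vector c n → Vector c n → R c
_∙_ {n = n} v w = Σ[ n ] (λ i → conj (v i) *R w i)

col : ∀ {c n k} → Matrix c n k → Fin k → Vector c n
col A j i = A i j

-- k-icube of norm λ (λ a positive integer; note v*v ∈ ℤ≥0)
IsIcube : ∀ {c} n k → Matrix c n k → ℕ → Set
IsIcube n k A lam =
  (∀ i → col A i ∙ col A i ≡ ι (+ lam)) ×
  (∀ i j → i ≢ j → col A i ∙ col A j ≡ 0R)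

sign : ∀ {c} → ℕ → R c → R c
sign zero x = x
sign (suc zero) x = -R x
sign (suc (suc m)) x = sign m x

det : ∀ {c} n → Matrix c n n → R c
det zero M = 1R
det (suc n) M =
  Σ[ suc n ] (λ j → sign (toℕ j) (M zero j *R det n (λ r s → M (suc r) (punchIn j s))))

_∣R_ : ∀ {c} → R c → R c → Set
_∣R_ {c} x y = Σ (R c) (λ q → y ≡ q *R x)

IncreasingRows : ∀ n k → (Fin k → Fin n) → Set
IncreasingRows n k s = ∀ i j → i Fin.< j → s i Fin.< s j

minor : ∀ {c} n k → Matrix c n k → (Fin k → Fin n) → R c
minor n k A s = det k (λ i j → A (s i) j)

IsDetDivisor : ∀ {c} n k → Matrix c n k → R c → Set
IsDetDivisor {c} n k A g =
  (∀ s → IncreasingRows n k s → g ∣R minor n k A s) ×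
  (∀ (d : R c) → (∀ s → IncreasingRows n k s → d ∣R minor n k A s) → d ∣R g)

InΛ : ∀ {c} n k → Matrix c n k → Vector c n → Set
InΛ n k A w = ∀ j → col A j ∙ w ≡ 0R

lincomb : ∀ {c n} m → (Fin m → R c) → (Fin m → Vector c n) → Vector c n
lincomb m x b i = Σ[ m ] (λ l → x l *R b l i)

IsFreeBasisOfΛ : ∀ {c} n k → Matrix c n k → (m : ℕ) → (Fin m → Vector c n) → Set
IsFreeBasisOfΛ {c} n k A m b =
  (∀ l → InΛ n k A (b l)) ×
  (∀ w → InΛ n k A w → Σ (Fin m → R c) (λ x → ∀ i → w i ≡ lincomb m x b i)) ×
  (∀ x y → (∀ i → lincomb m x b i ≡ lincomb m y b i) → ∀ l → x l ≡ y l)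

gram : ∀ {c n} m → (Fin m → Vector c n) → Matrix c m m
gram m b l l' = b l ∙ b l'

disc : ∀ {c n} m → (Fin m → Vector c n) → R c
disc m b = det m (gram m b)

_^_ : ℕ → ℕ → ℕ
x ^ zero = 1
x ^ suc k = x Data.Nat.* (x ^ k)

Basis : Case → ℕ → ℕ → Set
Basis c n m = Fin m → Vector c n

-- Row reduction over the Euclidean domain R gives a unimodular U with U A = (H ; 0), H square
-- of size k. The conjugated last n - k rows b₀ of U lie in Λ and form a basis of it: for w ∈ Λ
-- the coordinates y = U⁻¹ᴴ w satisfy Hᴴ y_top = Aᴴ w = 0, so y_top = 0 as det H ≠ 0; and
-- U U⁻¹ = 1 gives independence. For P = (A | b₀), Pᴴ P is block triangular with diagonal blocks
-- λ·1 and Gram(b₀), and U P is block triangular with diagonal blocks H and Gram(b₀). Since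
-- |det U| = 1 this gives λᵏ disc(b₀) = |det P|² = |det H|² disc(b₀)², i.e. λᵏ = |det H|² disc(b₀).
-- Finally det H is a k-th determinantal divisor: it divides every k × k minor of A = U⁻¹ (H ; 0),
-- and a common divisor of the minors divides det H = det(U_top A) by multilinearity. Bases of Λ,
-- and determinantal divisors, differ by units, which have |u|² = 1. If k > n, every k × k minor
-- of A vanishes, contradicting det(Aᴴ A) = λᵏ ≠ 0.

module Submission where

open import Defs
open import Data.Nat using (ℕ; _∸_; NonZero)
open import Data.Integer using (+_)
open import Data.Product using (Σ; _×_)
open import Relation.Binary.PropositionalEquality using (_≡_)

open import Algebra.Bundles using (CommutativeRing)
import Algebra.Properties.Ring as RingProperties
import Algebra.Solver.Ring
import Algebra.Solver.Ring.AlmostCommutativeRing as ACR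
open import Data.Empty using (⊥; ⊥-elim)
open import Data.Fin as Fin using (Fin; zero; suc; punchIn; toℕ; fromℕ; _↑ˡ_; _↑ʳ_; splitAt)
import Data.Fin.Properties as Finₚ
open import Data.Integer as ℤ using (ℤ; -[1+_]; ∣_∣; _⊖_)
import Data.Integer.DivMod as ℤ
import Data.Integer.Properties as ℤₚ
import Data.Integer.Tactic.RingSolver as ℤ-Solver
open import Data.Maybe using (Maybe; just; nothing)
open import Data.Nat as ℕ using (zero; suc; z≤n; s≤s)
import Data.Nat.Properties as ℕₚ
open import Data.Nat.Induction using (<-wellFounded)
open import Induction.WellFounded using (Acc; acc)
import Data.Nat.Tactic.RingSolver as ℕ-Solver
open import Data.Product using (_,_; proj₁; proj₂)
open import Data.Sum using (_⊎_; inj₁; inj₂; [_,_]′; fromInj₁)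
open import Data.Vec.Functional using (updateAt; _∷_)
open import Data.Vec.Functional.Properties
  using (updateAt-updates; updateAt-minimal; updateAt-updateAt; updateAt-id-local)
open import Function using (_∘_; const)
open import Level using (0ℓ)
open import Relation.Binary.PropositionalEquality
  using (_≢_; refl; sym; trans; cong; cong₂; subst; subst₂; isEquivalence; module ≡-Reasoning)
open import Relation.Nullary using (Dec; yes; no)
open import Relation.Nullary.Decidable using (¬?; _×-dec_)

-- The rings ℤ and ℤ[i]

+R-comm : ∀ {c} (x y : R c) → x +R y ≡ y +R x
+R-comm {rationals} x y = ℤₚ.+-comm x y
+R-comm {gaussian} (a +i b) (c +i d) = cong₂ _+i_ (ℤₚ.+-comm a c) (ℤₚ.+-comm b d)

+R-assoc : ∀ {c} (x y z : R c) → (x +R y) +R z ≡ x +R (y +R z)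
+R-assoc {rationals} x y z = ℤₚ.+-assoc x y z
+R-assoc {gaussian} (a +i b) (c +i d) (e +i f) =
  cong₂ _+i_ (ℤₚ.+-assoc a c e) (ℤₚ.+-assoc b d f)

+R-identityˡ : ∀ {c} (x : R c) → 0R +R x ≡ x
+R-identityˡ {rationals} x = ℤₚ.+-identityˡ x
+R-identityˡ {gaussian} (a +i b) = cong₂ _+i_ (ℤₚ.+-identityˡ a) (ℤₚ.+-identityˡ b)

+R-identityʳ : ∀ {c} (x : R c) → x +R 0R ≡ x
+R-identityʳ x = trans (+R-comm x 0R) (+R-identityˡ x)

+R-inverseˡ : ∀ {c} (x : R c) → (-R x) +R x ≡ 0R
+R-inverseˡ {rationals} x = ℤₚ.+-inverseˡ x
+R-inverseˡ {gaussian} (a +i b) = cong₂ _+i_ (ℤₚ.+-inverseˡ a) (ℤₚ.+-inverseˡ b)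

+R-inverseʳ : ∀ {c} (x : R c) → x +R (-R x) ≡ 0R
+R-inverseʳ x = trans (+R-comm x _) (+R-inverseˡ x)

*R-comm : ∀ {c} (x y : R c) → x *R y ≡ y *R x
*R-comm {rationals} x y = ℤₚ.*-comm x y
*R-comm {gaussian} (a +i b) (c +i d) = cong₂ _+i_ (re-comm a b c d) (im-comm a b c d)
  where
  re-comm : ∀ a b c d → a ℤ.* c ℤ.- b ℤ.* d ≡ c ℤ.* a ℤ.- d ℤ.* b
  re-comm = ℤ-Solver.solve-∀
  im-comm : ∀ a b c d → a ℤ.* d ℤ.+ b ℤ.* c ≡ c ℤ.* b ℤ.+ d ℤ.* a
  im-comm = ℤ-Solver.solve-∀

*R-assoc : ∀ {c} (x y z : R c) → (x *R y) *R z ≡ x *R (y *R z)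
*R-assoc {rationals} x y z = ℤₚ.*-assoc x y z
*R-assoc {gaussian} (a +i b) (c +i d) (e +i f) =
  cong₂ _+i_ (re-assoc a b c d e f) (im-assoc a b c d e f)
  where
  re-assoc : ∀ a b c d e f →
    (a ℤ.* c ℤ.- b ℤ.* d) ℤ.* e ℤ.- (a ℤ.* d ℤ.+ b ℤ.* c) ℤ.* f
    ≡ a ℤ.* (c ℤ.* e ℤ.- d ℤ.* f) ℤ.- b ℤ.* (c ℤ.* f ℤ.+ d ℤ.* e)
  re-assoc = ℤ-Solver.solve-∀
  im-assoc : ∀ a b c d e f →
    (a ℤ.* c ℤ.- b ℤ.* d) ℤ.* f ℤ.+ (a ℤ.* d ℤ.+ b ℤ.* c) ℤ.* e
    ≡ a ℤ.* (c ℤ.* f ℤ.+ d ℤ.* e) ℤ.+ b ℤ.* (c ℤ.* e ℤ.- d ℤ.* f)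
  im-assoc = ℤ-Solver.solve-∀

*R-identityˡ : ∀ {c} (x : R c) → 1R *R x ≡ x
*R-identityˡ {rationals} x = ℤₚ.*-identityˡ x
*R-identityˡ {gaussian} (a +i b) = cong₂ _+i_ (re-identity a b) (im-identity a b)
  where
  re-identity : ∀ a b → + 1 ℤ.* a ℤ.- + 0 ℤ.* b ≡ a
  re-identity = ℤ-Solver.solve-∀
  im-identity : ∀ a b → + 1 ℤ.* b ℤ.+ + 0 ℤ.* a ≡ b
  im-identity = ℤ-Solver.solve-∀

*R-distribʳ : ∀ {c} (x y z : R c) → (y +R z) *R x ≡ (y *R x) +R (z *R x)
*R-distribʳ {rationals} x y z = ℤₚ.*-distribʳ-+ x y z
*R-distribʳ {gaussian} (a +i b) (c +i d) (e +i f) =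
  cong₂ _+i_ (re-distrib a b c d e f) (im-distrib a b c d e f)
  where
  re-distrib : ∀ a b c d e f →
    (c ℤ.+ e) ℤ.* a ℤ.- (d ℤ.+ f) ℤ.* b ≡ (c ℤ.* a ℤ.- d ℤ.* b) ℤ.+ (e ℤ.* a ℤ.- f ℤ.* b)
  re-distrib = ℤ-Solver.solve-∀
  im-distrib : ∀ a b c d e f →
    (c ℤ.+ e) ℤ.* b ℤ.+ (d ℤ.+ f) ℤ.* a ≡ (c ℤ.* b ℤ.+ d ℤ.* a) ℤ.+ (e ℤ.* b ℤ.+ f ℤ.* a)
  im-distrib = ℤ-Solver.solve-∀

*R-distribˡ : ∀ {c} (x y z : R c) → x *R (y +R z) ≡ (x *R y) +R (x *R z)
*R-distribˡ x y z =
  trans (*R-comm x _) (trans (*R-distribʳ x y z) (cong₂ _+R_ (*R-comm y x) (*R-comm z x)))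

R-commutativeRing : Case → CommutativeRing 0ℓ 0ℓ
R-commutativeRing c = record
  { Carrier = R c ; _≈_ = _≡_ ; _+_ = _+R_ ; _*_ = _*R_ ; -_ = -R_ ; 0# = 0R ; 1# = 1R
  ; isCommutativeRing = record
    { isRing = record
      { +-isAbelianGroup = record
        { isGroup = record
          { isMonoid = record
            { isSemigroup = record
              { isMagma = record { isEquivalence = isEquivalence ; ∙-cong = cong₂ _+R_ }
              ; assoc = +R-assoc }
            ; identity = +R-identityˡ , +R-identityʳ }
          ; inverse = +R-inverseˡ , +R-inverseʳ
          ; ⁻¹-cong = cong (-R_) }
        ; comm = +R-comm }
      ; *-cong = cong₂ _*R_
      ; *-assoc = *R-assoc
      ; *-identity = *R-identityˡ , (λ x → trans (*R-comm x 1R) (*R-identityˡ x))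
      ; distrib = *R-distribˡ , *R-distribʳ
      }
    ; *-comm = *R-comm
    }
  }

ι-+ : ∀ {c} (a b : ℤ) → ι {c} (a ℤ.+ b) ≡ ι a +R ι b
ι-+ {rationals} a b = refl
ι-+ {gaussian} a b = refl

ι-* : ∀ {c} (a b : ℤ) → ι {c} (a ℤ.* b) ≡ ι a *R ι b
ι-* {rationals} a b = refl
ι-* {gaussian} a b = cong₂ _+i_ (re-* a b) (im-* a b)
  where
  re-* : ∀ a b → a ℤ.* b ≡ a ℤ.* b ℤ.- + 0 ℤ.* + 0
  re-* = ℤ-Solver.solve-∀
  im-* : ∀ a b → + 0 ≡ a ℤ.* + 0 ℤ.+ + 0 ℤ.* b
  im-* = ℤ-Solver.solve-∀

ι-neg : ∀ {c} (a : ℤ) → ι {c} (ℤ.- a) ≡ -R ι a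
ι-neg {rationals} a = refl
ι-neg {gaussian} a = refl

ι-injective : ∀ {c} {a b : ℤ} → ι {c} a ≡ ι b → a ≡ b
ι-injective {rationals} e = e
ι-injective {gaussian} e = cong re e

-- Constants in solver expressions are integers, embedded by ι.
module R-Solver (c : Case) where
  private
    almostCommutativeRing : ACR.AlmostCommutativeRing 0ℓ 0ℓ
    almostCommutativeRing = ACR.fromCommutativeRing (R-commutativeRing c)

    ι-morphism : ACR._-Raw-AlmostCommutative⟶_ ℤ.+-*-rawRing almostCommutativeRing
    ι-morphism = record
      { ⟦_⟧ = ι ; +-homo = ι-+ ; *-homo = ι-* ; -‿homo = ι-neg ; 0-homo = refl ; 1-homo = refl }

    ι-≟ : (a b : ℤ) → Maybe (ι {c} a ≡ ι b)
    ι-≟ a b with a ℤ.≟ b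
    ... | yes a≡b = just (cong ι a≡b)
    ... | no _ = nothing

  open Algebra.Solver.Ring ℤ.+-*-rawRing almostCommutativeRing ι-morphism ι-≟ public

conj-+ : ∀ {c} (x y : R c) → conj (x +R y) ≡ conj x +R conj y
conj-+ {rationals} x y = refl
conj-+ {gaussian} (a +i b) (d +i e) = cong ((a ℤ.+ d) +i_) (ℤₚ.neg-distrib-+ b e)

conj-neg : ∀ {c} (x : R c) → conj (-R x) ≡ -R conj x
conj-neg {rationals} x = refl
conj-neg {gaussian} (a +i b) = refl

conj-* : ∀ {c} (x y : R c) → conj (x *R y) ≡ conj x *R conj y
conj-* {rationals} x y = refl
conj-* {gaussian} (a +i b) (d +i e) = cong₂ _+i_ (re-* a b d e) (im-* a b d e)
  where
  re-* : ∀ a b d e → a ℤ.* d ℤ.- b ℤ.* e ≡ a ℤ.* d ℤ.- (ℤ.- b) ℤ.* (ℤ.- e)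
  re-* = ℤ-Solver.solve-∀
  im-* : ∀ a b d e → ℤ.- (a ℤ.* e ℤ.+ b ℤ.* d) ≡ a ℤ.* (ℤ.- e) ℤ.+ (ℤ.- b) ℤ.* d
  im-* = ℤ-Solver.solve-∀

conj-involutive : ∀ {c} (x : R c) → conj (conj x) ≡ x
conj-involutive {rationals} x = refl
conj-involutive {gaussian} (a +i b) = cong (a +i_) (ℤₚ.neg-involutive b)

conj-ι : ∀ {c} (a : ℤ) → conj (ι {c} a) ≡ ι a
conj-ι {rationals} a = refl
conj-ι {gaussian} a = refl

module _ {c : Case} where
  open CommutativeRing (R-commutativeRing c) public
    using () renaming (zeroˡ to *R-zeroˡ; zeroʳ to *R-zeroʳ; *-identityʳ to *R-identityʳ)
  open RingProperties (CommutativeRing.ring (R-commutativeRing c)) public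
    using () renaming (-0#≈0# to -R-0R; -‿distribˡ-* to -R-distribˡ-*; -‿involutive to -R-involutive;
                       +-inverseˡ-unique to x+y≡0⇒x≡-y; x∙y⁻¹≈ε⇒x≈y to x-y≡0⇒x≡y)

  conj-0R : conj (0R {c}) ≡ 0R
  conj-0R = conj-ι (+ 0)

  conj-1R : conj (1R {c}) ≡ 1R
  conj-1R = conj-ι (+ 1)

i*i≡+∣i∣*∣i∣ : ∀ i → i ℤ.* i ≡ + (∣ i ∣ ℕ.* ∣ i ∣)
i*i≡+∣i∣*∣i∣ (+ n) = ℤₚ.+◃n≡+n (n ℕ.* n)
i*i≡+∣i∣*∣i∣ -[1+ n ] = refl

norm : ∀ {c} → R c → ℕ
norm {rationals} x = ∣ x ∣ ℕ.* ∣ x ∣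
norm {gaussian} (a +i b) = ∣ a ∣ ℕ.* ∣ a ∣ ℕ.+ ∣ b ∣ ℕ.* ∣ b ∣

absSq≡ι-norm : ∀ {c} (x : R c) → absSq x ≡ ι (+ norm x)
absSq≡ι-norm {rationals} x = i*i≡+∣i∣*∣i∣ x
absSq≡ι-norm {gaussian} (a +i b) =
  cong₂ _+i_ (trans (re-absSq a b) (cong₂ ℤ._+_ (i*i≡+∣i∣*∣i∣ a) (i*i≡+∣i∣*∣i∣ b))) (im-absSq a b)
  where
  re-absSq : ∀ a b → a ℤ.* a ℤ.- (ℤ.- b) ℤ.* b ≡ a ℤ.* a ℤ.+ b ℤ.* b
  re-absSq = ℤ-Solver.solve-∀
  im-absSq : ∀ a b → a ℤ.* b ℤ.+ (ℤ.- b) ℤ.* a ≡ + 0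
  im-absSq = ℤ-Solver.solve-∀

absSq-* : ∀ {c} (x y : R c) → absSq (x *R y) ≡ absSq x *R absSq y
absSq-* {c} x y = trans (cong (_*R (x *R y)) (conj-* x y)) (solve 4
  (λ x̄ ȳ x y → (x̄ :* ȳ) :* (x :* y) := (x̄ :* x) :* (ȳ :* y)) refl (conj x) (conj y) x y)
  where open R-Solver c

norm-* : ∀ {c} (x y : R c) → norm (x *R y) ≡ norm x ℕ.* norm y
norm-* {c} x y = ℤₚ.+-injective (ι-injective {c} (begin
  ι (+ norm (x *R y))            ≡⟨ absSq≡ι-norm (x *R y) ⟨
  absSq (x *R y)                 ≡⟨ absSq-* x y ⟩
  absSq x *R absSq y             ≡⟨ cong₂ _*R_ (absSq≡ι-norm x) (absSq≡ι-norm y) ⟩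
  ι (+ norm x) *R ι (+ norm y)   ≡⟨ ι-* (+ norm x) (+ norm y) ⟨
  ι (+ norm x ℤ.* + norm y)      ≡⟨ cong ι (ℤₚ.pos-* (norm x) (norm y)) ⟨
  ι (+ (norm x ℕ.* norm y))      ∎))
  where open ≡-Reasoning

norm-conj : ∀ {c} (x : R c) → norm (conj x) ≡ norm x
norm-conj {rationals} x = refl
norm-conj {gaussian} (a +i b) = cong (λ t → ∣ a ∣ ℕ.* ∣ a ∣ ℕ.+ t ℕ.* t) (ℤₚ.∣-i∣≡∣i∣ b)

norm-0R : ∀ {c} → norm (0R {c}) ≡ 0
norm-0R {rationals} = refl
norm-0R {gaussian} = refl

norm-1R : ∀ {c} → norm (1R {c}) ≡ 1
norm-1R {rationals} = refl
norm-1R {gaussian} = refl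

norm≡0⇒≡0R : ∀ {c} (x : R c) → norm x ≡ 0 → x ≡ 0R
norm≡0⇒≡0R {rationals} x = i*i≡0⇒i≡0 x
  where
  i*i≡0⇒i≡0 : ∀ i → ∣ i ∣ ℕ.* ∣ i ∣ ≡ 0 → i ≡ + 0
  i*i≡0⇒i≡0 i e = [ ℤₚ.∣i∣≡0⇒i≡0 , ℤₚ.∣i∣≡0⇒i≡0 ]′ (ℕₚ.m*n≡0⇒m≡0∨n≡0 ∣ i ∣ e)
norm≡0⇒≡0R {gaussian} (a +i b) e =
  cong₂ _+i_ (norm≡0⇒≡0R {rationals} a (ℕₚ.m+n≡0⇒m≡0 _ e))
             (norm≡0⇒≡0R {rationals} b (ℕₚ.m+n≡0⇒n≡0 (∣ a ∣ ℕ.* ∣ a ∣) e))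

≢0R⇒norm>0 : ∀ {c} (x : R c) → x ≢ 0R → 0 ℕ.< norm x
≢0R⇒norm>0 x x≢0 = ℕₚ.n≢0⇒n>0 (x≢0 ∘ norm≡0⇒≡0R x)

_≟0R : ∀ {c} (x : R c) → Dec (x ≡ 0R)
_≟0R {rationals} x = x ℤ.≟ + 0
_≟0R {gaussian} (a +i b) with a ℤ.≟ + 0 | b ℤ.≟ + 0
... | yes a≡0 | yes b≡0 = yes (cong₂ _+i_ a≡0 b≡0)
... | no a≢0  | _       = no (a≢0 ∘ cong re)
... | yes _   | no b≢0  = no (b≢0 ∘ cong im)

x*y≡0⇒x≡0∨y≡0 : ∀ {c} (x y : R c) → x *R y ≡ 0R → x ≡ 0R ⊎ y ≡ 0R
x*y≡0⇒x≡0∨y≡0 {c} x y e with ℕₚ.m*n≡0⇒m≡0∨n≡0 (norm x) (trans (sym (norm-* x y)) (trans (cong norm e) (norm-0R {c})))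
... | inj₁ ‖x‖≡0 = inj₁ (norm≡0⇒≡0R x ‖x‖≡0)
... | inj₂ ‖y‖≡0 = inj₂ (norm≡0⇒≡0R y ‖y‖≡0)

x*y≡1⇒absSq[x]≡1 : ∀ {c} (x y : R c) → x *R y ≡ 1R → absSq x ≡ 1R
x*y≡1⇒absSq[x]≡1 {c} x y e = trans (absSq≡ι-norm x) (cong (λ t → ι (+ t))
  (ℕₚ.m*n≡1⇒m≡1 (norm x) (norm y) (trans (sym (norm-* x y)) (trans (cong norm e) (norm-1R {c})))))

2*m≤n⇒m<n : ∀ {m n} → 0 ℕ.< n → 2 ℕ.* m ℕ.≤ n → m ℕ.< n
2*m≤n⇒m<n {zero} 0<n _ = 0<n
2*m≤n⇒m<n {suc m} {n} _ 2m≤n =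
  ℕₚ.<-≤-trans (ℕₚ.m<m+n (suc m) (s≤s z≤n)) (subst (λ t → suc m ℕ.+ t ℕ.≤ n) (ℕₚ.+-identityʳ (suc m)) 2m≤n)

nearest-multiple : ∀ (p : ℤ) (m : ℕ) .{{_ : NonZero m}} → Σ ℤ (λ q → 2 ℕ.* ∣ p ℤ.- q ℤ.* + m ∣ ℕ.≤ m)
nearest-multiple p m with 2 ℕ.* (p ℤ.% + m) ℕ.≤? m
... | yes 2r≤m = p ℤ./ + m , subst (λ t → 2 ℕ.* ∣ t ∣ ℕ.≤ m) (sym p-qm≡r) 2r≤m
  where
  p-qm≡r : p ℤ.- (p ℤ./ + m) ℤ.* + m ≡ + (p ℤ.% + m)
  p-qm≡r = trans (cong (λ t → t ℤ.- (p ℤ./ + m) ℤ.* + m) (ℤ.a≡a%n+[a/n]*n p (+ m)))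
                 (cancel (+ (p ℤ.% + m)) (p ℤ./ + m) (+ m))
    where
    cancel : ∀ r q m → (r ℤ.+ q ℤ.* m) ℤ.- q ℤ.* m ≡ r
    cancel = ℤ-Solver.solve-∀
... | no 2r≰m = p ℤ./ + m ℤ.+ + 1 , subst (λ t → 2 ℕ.* t ℕ.≤ m) (sym ∣p-q'm∣≡m-r) 2[m-r]≤m
  where
  r = p ℤ.% + m
  r≤m : r ℕ.≤ m
  r≤m = ℕₚ.<⇒≤ (ℤ.n%d<d p (+ m))
  ∣p-q'm∣≡m-r : ∣ p ℤ.- (p ℤ./ + m ℤ.+ + 1) ℤ.* + m ∣ ≡ m ∸ r
  ∣p-q'm∣≡m-r = begin
    ∣ p ℤ.- (p ℤ./ + m ℤ.+ + 1) ℤ.* + m ∣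
      ≡⟨ cong (λ t → ∣ t ℤ.- (p ℤ./ + m ℤ.+ + 1) ℤ.* + m ∣) (ℤ.a≡a%n+[a/n]*n p (+ m)) ⟩
    ∣ (+ r ℤ.+ p ℤ./ + m ℤ.* + m) ℤ.- (p ℤ./ + m ℤ.+ + 1) ℤ.* + m ∣
      ≡⟨ cong ∣_∣ (overshoot (+ r) (p ℤ./ + m) (+ m)) ⟩
    ∣ + r ℤ.- + m ∣ ≡⟨ cong ∣_∣ (ℤₚ.m-n≡m⊖n r m) ⟩
    ∣ r ⊖ m ∣       ≡⟨ ℤₚ.∣⊖∣-≤ r≤m ⟩
    m ∸ r           ∎
    where
    open ≡-Reasoning
    overshoot : ∀ r q m → (r ℤ.+ q ℤ.* m) ℤ.- (q ℤ.+ + 1) ℤ.* m ≡ r ℤ.- m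
    overshoot = ℤ-Solver.solve-∀
  2[m-r]≤m : 2 ℕ.* (m ∸ r) ℕ.≤ m
  2[m-r]≤m = begin
    2 ℕ.* (m ∸ r)       ≡⟨ ℕₚ.*-distribˡ-∸ 2 m r ⟩
    2 ℕ.* m ∸ 2 ℕ.* r   ≤⟨ ℕₚ.∸-monoʳ-≤ (2 ℕ.* m) (ℕₚ.<⇒≤ (ℕₚ.≰⇒> 2r≰m)) ⟩
    2 ℕ.* m ∸ m         ≡⟨ cong (λ t → m ℕ.+ t ∸ m) (ℕₚ.+-identityʳ m) ⟩
    m ℕ.+ m ∸ m         ≡⟨ ℕₚ.m+n∸n≡m m m ⟩
    m                   ∎
    where open ℕₚ.≤-Reasoning

^-≢0 : ∀ x k → x ≢ 0 → x ^ k ≢ 0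
^-≢0 x (suc k) x≢0 xᵏ⁺¹≡0 = [ x≢0 , ^-≢0 x k x≢0 ]′ (ℕₚ.m*n≡0⇒m≡0∨n≡0 x xᵏ⁺¹≡0)

ι-≢0R : ∀ {c} a → a ≢ 0 → ι {c} (+ a) ≢ 0R
ι-≢0R a a≢0 = a≢0 ∘ ℤₚ.+-injective ∘ ι-injective

absSq≡0⇒≡0R : ∀ {c} (x : R c) → absSq x ≡ 0R → x ≡ 0R
absSq≡0⇒≡0R x e = norm≡0⇒≡0R x (ℤₚ.+-injective (ι-injective (trans (sym (absSq≡ι-norm x)) e)))

x*m≡e₁²+e₂²⇒2x≤m : ∀ x m e₁ e₂ .{{_ : NonZero m}} → x ℕ.* m ≡ e₁ ℕ.* e₁ ℕ.+ e₂ ℕ.* e₂ →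
  2 ℕ.* e₁ ℕ.≤ m → 2 ℕ.* e₂ ℕ.≤ m → 2 ℕ.* x ℕ.≤ m
x*m≡e₁²+e₂²⇒2x≤m x m e₁ e₂ xm≡ 2e₁≤m 2e₂≤m = ℕₚ.*-cancelˡ-≤ 2 (ℕₚ.*-cancelʳ-≤ _ _ m (begin
  2 ℕ.* (2 ℕ.* x) ℕ.* m                                   ≡⟨ pull-4 x m ⟩
  4 ℕ.* (x ℕ.* m)                                         ≡⟨ cong (4 ℕ.*_) xm≡ ⟩
  4 ℕ.* (e₁ ℕ.* e₁ ℕ.+ e₂ ℕ.* e₂)                         ≡⟨ push-4 e₁ e₂ ⟩
  (2 ℕ.* e₁) ℕ.* (2 ℕ.* e₁) ℕ.+ (2 ℕ.* e₂) ℕ.* (2 ℕ.* e₂) ≤⟨ ℕₚ.+-mono-≤ (ℕₚ.*-mono-≤ 2e₁≤m 2e₁≤m) (ℕₚ.*-mono-≤ 2e₂≤m 2e₂≤m) ⟩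
  m ℕ.* m ℕ.+ m ℕ.* m                                     ≡⟨ double m ⟨
  2 ℕ.* m ℕ.* m                                           ∎))
  where
  open ℕₚ.≤-Reasoning
  pull-4 : ∀ x y → 2 ℕ.* (2 ℕ.* x) ℕ.* y ≡ 4 ℕ.* (x ℕ.* y)
  pull-4 = ℕ-Solver.solve-∀
  push-4 : ∀ x y → 4 ℕ.* (x ℕ.* x ℕ.+ y ℕ.* y) ≡ (2 ℕ.* x) ℕ.* (2 ℕ.* x) ℕ.+ (2 ℕ.* y) ℕ.* (2 ℕ.* y)
  push-4 = ℕ-Solver.solve-∀
  double : ∀ y → 2 ℕ.* y ℕ.* y ≡ y ℕ.* y ℕ.+ y ℕ.* y
  double = ℕ-Solver.solve-∀

euclidean-division : ∀ {c} (a b : R c) → b ≢ 0R → Σ (R c) (λ q → norm (a -R q *R b) ℕ.< norm b)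
euclidean-division {rationals} a b b≢0 =
  q , subst (λ t → norm {rationals} t ℕ.< norm {rationals} b) (sym a-qb≡r) (ℕₚ.*-mono-< r<∣b∣ r<∣b∣)
  where
  instance
    b-nonZero : ℤ.NonZero b
    b-nonZero = ℤ.≢-nonZero b≢0
  q = a ℤ./ b
  a-qb≡r : a ℤ.- q ℤ.* b ≡ + (a ℤ.% b)
  a-qb≡r = trans (cong (λ t → t ℤ.- q ℤ.* b) (ℤ.a≡a%n+[a/n]*n a b)) (cancel (+ (a ℤ.% b)) q b)
    where
    cancel : ∀ r q b → (r ℤ.+ q ℤ.* b) ℤ.- q ℤ.* b ≡ r
    cancel = ℤ-Solver.solve-∀
  r<∣b∣ : a ℤ.% b ℕ.< ∣ b ∣
  r<∣b∣ = ℤ.n%d<d a b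
euclidean-division {gaussian} a b b≢0 = q , 2*m≤n⇒m<n 0<m 2‖r‖≤m
  where
  open R-Solver gaussian
  m = norm b
  0<m : 0 ℕ.< m
  0<m = ≢0R⇒norm>0 b b≢0
  instance
    m-nonZero : NonZero m
    m-nonZero = ℕ.>-nonZero 0<m
  -- q is a b̄ / |b|² rounded componentwise to the nearest Gaussian integer
  w = a *R conj b
  q₁ = proj₁ (nearest-multiple (re w) m)
  q₂ = proj₁ (nearest-multiple (im w) m)
  q = q₁ +i q₂
  r = a -R q *R b
  e₁ = re w ℤ.- q₁ ℤ.* + m
  e₂ = im w ℤ.- q₂ ℤ.* + m
  r*b̄≡e₁+ie₂ : r *R conj b ≡ e₁ +i e₂
  r*b̄≡e₁+ie₂ = begin
    (a -R q *R b) *R conj b      ≡⟨ solve 4 (λ a q b b̄ → (a :- q :* b) :* b̄ := a :* b̄ :- q :* (b̄ :* b)) refl a q b (conj b) ⟩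
    w -R q *R absSq b            ≡⟨ cong (λ t → w -R q *R t) (absSq≡ι-norm b) ⟩
    w -R q *R ι (+ m)            ≡⟨ cong₂ _+i_ (re-part (re w) q₁ q₂ (+ m)) (im-part (im w) q₁ q₂ (+ m)) ⟩
    e₁ +i e₂                     ∎
    where
    open ≡-Reasoning
    re-part : ∀ u q₁ q₂ m → u ℤ.+ ℤ.- (q₁ ℤ.* m ℤ.- q₂ ℤ.* + 0) ≡ u ℤ.- q₁ ℤ.* m
    re-part = ℤ-Solver.solve-∀
    im-part : ∀ v q₁ q₂ m → v ℤ.+ ℤ.- (q₁ ℤ.* + 0 ℤ.+ q₂ ℤ.* m) ≡ v ℤ.- q₂ ℤ.* m
    im-part = ℤ-Solver.solve-∀
  ‖r‖*m≡ : norm r ℕ.* m ≡ ∣ e₁ ∣ ℕ.* ∣ e₁ ∣ ℕ.+ ∣ e₂ ∣ ℕ.* ∣ e₂ ∣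
  ‖r‖*m≡ = trans (cong (norm r ℕ.*_) (sym (norm-conj b)))
                  (trans (sym (norm-* r (conj b))) (cong norm r*b̄≡e₁+ie₂))
  2‖r‖≤m : 2 ℕ.* norm r ℕ.≤ m
  2‖r‖≤m = x*m≡e₁²+e₂²⇒2x≤m (norm r) m ∣ e₁ ∣ ∣ e₂ ∣ ‖r‖*m≡
             (proj₂ (nearest-multiple (re w) m)) (proj₂ (nearest-multiple (im w) m))

module _ {c : Case} where
  open R-Solver c

  record Bezout (a b : R c) : Set where
    field
      d a₀ b₀ s t : R c
      a≡a₀d : a ≡ a₀ *R d
      b≡b₀d : b ≡ b₀ *R d
      sa₀+tb₀≡1 : s *R a₀ +R t *R b₀ ≡ 1R

  bezout-acc : ∀ (a b : R c) → Acc ℕ._<_ (norm b) → Bezout a b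
  bezout-acc a b (acc rs) with b ≟0R
  ... | yes b≡0 = record
    { d = a ; a₀ = 1R ; b₀ = 0R ; s = 1R ; t = 0R
    ; a≡a₀d = sym (*R-identityˡ a)
    ; b≡b₀d = trans b≡0 (solve 1 (λ a → con (+ 0) := con (+ 0) :* a) refl a)
    ; sa₀+tb₀≡1 = solve 0 (con (+ 1) :* con (+ 1) :+ con (+ 0) :* con (+ 0) := con (+ 1)) refl }
  ... | no b≢0 = record
    { d = d ; a₀ = q *R a₀ +R b₀ ; b₀ = a₀ ; s = t ; t = s -R t *R q
    ; a≡a₀d = trans (solve 3 (λ a q b → a := (a :- q :* b) :+ q :* b) refl a q b)
        (trans (cong₂ (λ u v → u +R q *R v) b≡b₀d a≡a₀d)
               (solve 4 (λ b₀ q a₀ d → b₀ :* d :+ q :* (a₀ :* d) := (q :* a₀ :+ b₀) :* d) refl b₀ q a₀ d))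
    ; b≡b₀d = a≡a₀d
    ; sa₀+tb₀≡1 = trans (solve 5 (λ s t q a₀ b₀ → t :* (q :* a₀ :+ b₀) :+ (s :- t :* q) :* a₀ := s :* a₀ :+ t :* b₀)
                                 refl s t q a₀ b₀) sa₀+tb₀≡1 }
    where
    q = proj₁ (euclidean-division a b b≢0)
    open Bezout (bezout-acc b (a -R q *R b) (rs (proj₂ (euclidean-division a b b≢0))))

  bezout : ∀ (a b : R c) → Bezout a b
  bezout a b = bezout-acc a b (<-wellFounded (norm b))

  *R-cancelʳ : ∀ (a b d : R c) → d ≢ 0R → a *R d ≡ b *R d → a ≡ b
  *R-cancelʳ a b d d≢0 ad≡bd with x*y≡0⇒x≡0∨y≡0 (a -R b) d [a-b]d≡0
    where
    [a-b]d≡0 : (a -R b) *R d ≡ 0R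
    [a-b]d≡0 = trans (solve 3 (λ a b d → (a :- b) :* d := a :* d :- b :* d) refl a b d)
                     (trans (cong (_-R b *R d) ad≡bd) (+R-inverseʳ _))
  ... | inj₁ a-b≡0 = x-y≡0⇒x≡y a b a-b≡0
  ... | inj₂ d≡0 = ⊥-elim (d≢0 d≡0)

  associates⇒absSq≡ : ∀ (x y : R c) → x ≢ 0R → x ∣R y → y ∣R x → absSq y ≡ absSq x
  associates⇒absSq≡ x y x≢0 (u , y≡ux) (v , x≡vy) = begin
    absSq y                 ≡⟨ cong absSq y≡ux ⟩
    absSq (u *R x)          ≡⟨ absSq-* u x ⟩
    absSq u *R absSq x      ≡⟨ cong (_*R absSq x) (x*y≡1⇒absSq[x]≡1 u v (trans (*R-comm u v) vu≡1)) ⟩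
    1R *R absSq x           ≡⟨ *R-identityˡ _ ⟩
    absSq x                 ∎
    where
    open ≡-Reasoning
    vu≡1 : v *R u ≡ 1R
    vu≡1 = *R-cancelʳ (v *R u) 1R x x≢0
      (trans (*R-assoc v u x) (trans (cong (v *R_) (sym y≡ux)) (trans (sym x≡vy) (sym (*R-identityˡ x)))))

-- Sums and matrices

module _ {c : Case} where
  open R-Solver c

  Σ-cong : ∀ n {f g : Fin n → R c} → (∀ i → f i ≡ g i) → Σ[ n ] f ≡ Σ[ n ] g
  Σ-cong zero f≗g = refl
  Σ-cong (suc n) f≗g = cong₂ _+R_ (f≗g zero) (Σ-cong n (f≗g ∘ suc))

  Σ-zero : ∀ n {f : Fin n → R c} → (∀ i → f i ≡ 0R) → Σ[ n ] f ≡ 0R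
  Σ-zero zero f≗0 = refl
  Σ-zero (suc n) f≗0 = trans (cong₂ _+R_ (f≗0 zero) (Σ-zero n (f≗0 ∘ suc))) (+R-identityˡ 0R)

  Σ-distrib-+ : ∀ n (f g : Fin n → R c) → Σ[ n ] (λ i → f i +R g i) ≡ Σ[ n ] f +R Σ[ n ] g
  Σ-distrib-+ zero f g = sym (+R-identityˡ 0R)
  Σ-distrib-+ (suc n) f g = trans (cong ((f zero +R g zero) +R_) (Σ-distrib-+ n _ _))
    (solve 4 (λ a b c d → (a :+ b) :+ (c :+ d) := (a :+ c) :+ (b :+ d)) refl (f zero) (g zero) _ _)

  *R-distribˡ-Σ : ∀ n (a : R c) (f : Fin n → R c) → a *R Σ[ n ] f ≡ Σ[ n ] (λ i → a *R f i)
  *R-distribˡ-Σ zero a f = *R-zeroʳ a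
  *R-distribˡ-Σ (suc n) a f = trans (*R-distribˡ a _ _) (cong (a *R f zero +R_) (*R-distribˡ-Σ n a _))

  *R-distribʳ-Σ : ∀ n (a : R c) (f : Fin n → R c) → Σ[ n ] f *R a ≡ Σ[ n ] (λ i → f i *R a)
  *R-distribʳ-Σ n a f =
    trans (*R-comm _ a) (trans (*R-distribˡ-Σ n a f) (Σ-cong n (λ i → *R-comm a (f i))))

  Σ-comm : ∀ n m (f : Fin n → Fin m → R c) →
    Σ[ n ] (λ i → Σ[ m ] (λ j → f i j)) ≡ Σ[ m ] (λ j → Σ[ n ] (λ i → f i j))
  Σ-comm zero m f = sym (Σ-zero m (λ _ → refl))
  Σ-comm (suc n) m f =
    trans (cong (Σ[ m ] (f zero) +R_) (Σ-comm n m (f ∘ suc))) (sym (Σ-distrib-+ m _ _))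

  Σ-single : ∀ n (f : Fin n → R c) (i : Fin n) → (∀ j → j ≢ i → f j ≡ 0R) → Σ[ n ] f ≡ f i
  Σ-single (suc n) f zero f≗0 =
    trans (cong (f zero +R_) (Σ-zero n (λ j → f≗0 (suc j) (λ ())))) (+R-identityʳ _)
  Σ-single (suc n) f (suc i) f≗0 =
    trans (cong₂ _+R_ (f≗0 zero (λ ())) (Σ-single n _ i (λ j j≢i → f≗0 (suc j) (j≢i ∘ Finₚ.suc-injective))))
          (+R-identityˡ _)

  Σ-splitAt : ∀ k m (f : Fin (k ℕ.+ m) → R c) →
    Σ[ k ℕ.+ m ] f ≡ Σ[ k ] (λ i → f (i ↑ˡ m)) +R Σ[ m ] (λ j → f (k ↑ʳ j))
  Σ-splitAt zero m f = sym (+R-identityˡ _)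
  Σ-splitAt (suc k) m f = trans (cong (f zero +R_) (Σ-splitAt k m (f ∘ suc))) (sym (+R-assoc _ _ _))

  conj-Σ : ∀ n (f : Fin n → R c) → conj (Σ[ n ] f) ≡ Σ[ n ] (λ i → conj (f i))
  conj-Σ zero f = conj-0R
  conj-Σ (suc n) f = trans (conj-+ _ _) (cong (conj (f zero) +R_) (conj-Σ n _))

  sgn : ℕ → R c
  sgn m = sign m 1R

  sign≡sgn* : ∀ m (x : R c) → sign m x ≡ sgn m *R x
  sign≡sgn* zero x = sym (*R-identityˡ x)
  sign≡sgn* (suc zero) x = trans (cong (-R_) (sym (*R-identityˡ x))) (-R-distribˡ-* 1R x)
  sign≡sgn* (suc (suc m)) x = sign≡sgn* m x

  sgn-suc : ∀ m → sgn (suc m) ≡ -R sgn m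
  sgn-suc zero = refl
  sgn-suc (suc zero) = sym (-R-involutive 1R)
  sgn-suc (suc (suc m)) = sgn-suc m

  conj-sgn : ∀ m → conj (sgn m) ≡ sgn m
  conj-sgn zero = conj-1R
  conj-sgn (suc zero) = trans (conj-neg 1R) (cong (-R_) conj-1R)
  conj-sgn (suc (suc m)) = conj-sgn m

  sign-0R : ∀ m → sign {c} m 0R ≡ 0R
  sign-0R m = trans (sign≡sgn* m 0R) (*R-zeroʳ _)

firstRowMinor : ∀ {c n} → Matrix c (suc n) (suc n) → Fin (suc n) → Matrix c n n
firstRowMinor M j r s = M (suc r) (punchIn j s)

firstColumnMinor : ∀ {c n} → Matrix c (suc n) (suc n) → Fin (suc n) → Matrix c n n
firstColumnMinor M i r s = M (punchIn i r) (suc s)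

_ᵀ : ∀ {c m n} → Matrix c m n → Matrix c n m
(M ᵀ) i j = M j i

infix 10 _ᴴ
_ᴴ : ∀ {c m n} → Matrix c m n → Matrix c n m
(M ᴴ) i j = conj (M j i)

conjugate : ∀ {c m n} → Matrix c m n → Matrix c m n
conjugate M i j = conj (M i j)

setRow : ∀ {k} {A : Set} → (Fin k → A) → Fin k → A → Fin k → A
setRow X i v = updateAt X i (const v)

setRow-updates : ∀ {k} {A : Set} (X : Fin k → A) i v → setRow X i v i ≡ v
setRow-updates X i v = updateAt-updates i X

setRow-minimal : ∀ {k} {A : Set} (X : Fin k → A) i v r → r ≢ i → setRow X i v r ≡ X r
setRow-minimal X i v r r≢i = updateAt-minimal r i X r≢i

setRow-setRow : ∀ {k} {A : Set} (X : Fin k → A) i u v r → setRow (setRow X i u) i v r ≡ setRow X i v r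
setRow-setRow X i u v = updateAt-updateAt i X

setRow-self : ∀ {k} {A : Set} (X : Fin k → A) i r → setRow X i (X i) r ≡ X r
setRow-self X i = updateAt-id-local i X refl

setRows : ∀ {k} {A : Set} → (Fin k → A) → Fin k → A → Fin k → A → Fin k → A
setRows X i u j v = setRow (setRow X i u) j v

setRows-i : ∀ {k} {A : Set} (X : Fin k → A) i u j v → i ≢ j → setRows X i u j v i ≡ u
setRows-i X i u j v i≢j = trans (setRow-minimal _ j v i i≢j) (setRow-updates X i u)

setRows-j : ∀ {k} {A : Set} (X : Fin k → A) i u j v → setRows X i u j v j ≡ v
setRows-j X i u j v = setRow-updates _ j v

setRows-other : ∀ {k} {A : Set} (X : Fin k → A) i u j v r → r ≢ i → r ≢ j → setRows X i u j v r ≡ X r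
setRows-other X i u j v r r≢i r≢j = trans (setRow-minimal _ j v r r≢j) (setRow-minimal X i u r r≢i)

setRows-offˡ : ∀ {k} {A : Set} (X : Fin k → A) i u u' j v r → r ≢ i → setRows X i u j v r ≡ setRows X i u' j v r
setRows-offˡ X i u u' j v r r≢i with r Finₚ.≟ j
... | yes refl = trans (setRows-j X i u j v) (sym (setRows-j X i u' j v))
... | no r≢j = trans (setRows-other X i u j v r r≢i r≢j) (sym (setRows-other X i u' j v r r≢i r≢j))

setRows-offʳ : ∀ {k} {A : Set} (X : Fin k → A) i u j v v' r → r ≢ j → setRows X i u j v r ≡ setRows X i u j v' r
setRows-offʳ X i u j v v' r r≢j = trans (setRow-minimal _ j v r r≢j) (sym (setRow-minimal _ j v' r r≢j))

setRows-self : ∀ {k} {A : Set} (X : Fin k → A) i j r → setRows X i (X i) j (X j) r ≡ X r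
setRows-self X i j r with r Finₚ.≟ j
... | yes refl = setRows-j X i (X i) r (X r)
... | no r≢j = trans (setRow-minimal _ j (X j) r r≢j) (setRow-self X i r)

module _ {c : Case} where

  infix 4 _≋_
  _≋_ : ∀ {m n} → Matrix c m n → Matrix c m n → Set
  M ≋ N = ∀ i j → M i j ≡ N i j

  ≋-trans : ∀ {m n} {L M N : Matrix c m n} → L ≋ M → M ≋ N → L ≋ N
  ≋-trans L≋M M≋N i j = trans (L≋M i j) (M≋N i j)

  ≋-sym : ∀ {m n} {M N : Matrix c m n} → M ≋ N → N ≋ M
  ≋-sym M≋N i j = sym (M≋N i j)

  δ : ∀ {n} → Matrix c n n
  δ zero zero = 1R
  δ zero (suc j) = 0R
  δ (suc i) zero = 0R
  δ (suc i) (suc j) = δ i j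

  δ-diag : ∀ {n} (i : Fin n) → δ i i ≡ 1R
  δ-diag zero = refl
  δ-diag (suc i) = δ-diag i

  δ-offdiag : ∀ {n} (i j : Fin n) → i ≢ j → δ i j ≡ 0R
  δ-offdiag zero zero i≢j = ⊥-elim (i≢j refl)
  δ-offdiag zero (suc j) i≢j = refl
  δ-offdiag (suc i) zero i≢j = refl
  δ-offdiag (suc i) (suc j) i≢j = δ-offdiag i j (i≢j ∘ cong suc)

  δ-sym : ∀ {n} (i j : Fin n) → δ i j ≡ δ j i
  δ-sym zero zero = refl
  δ-sym zero (suc j) = refl
  δ-sym (suc i) zero = refl
  δ-sym (suc i) (suc j) = δ-sym i j

  δ-↑ʳ : ∀ k {m} (l l' : Fin m) → δ (k ↑ʳ l) (k ↑ʳ l') ≡ δ l l'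
  δ-↑ʳ zero l l' = refl
  δ-↑ʳ (suc k) l l' = δ-↑ʳ k l l'

  conj-δ : ∀ {n} (i j : Fin n) → conj (δ i j) ≡ δ i j
  conj-δ zero zero = conj-1R
  conj-δ zero (suc j) = conj-0R
  conj-δ (suc i) zero = conj-0R
  conj-δ (suc i) (suc j) = conj-δ i j

  Σ-δˡ : ∀ n (i : Fin n) (f : Fin n → R c) → Σ[ n ] (λ j → δ i j *R f j) ≡ f i
  Σ-δˡ n i f = trans
    (Σ-single n _ i (λ j j≢i → trans (cong (_*R f j) (δ-offdiag i j (j≢i ∘ sym))) (*R-zeroˡ _)))
    (trans (cong (_*R f i) (δ-diag i)) (*R-identityˡ _))

  Σ-δʳ : ∀ n (i : Fin n) (f : Fin n → R c) → Σ[ n ] (λ j → f j *R δ j i) ≡ f i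
  Σ-δʳ n i f = trans (Σ-cong n (λ j → trans (*R-comm _ _) (cong (_*R f j) (δ-sym j i)))) (Σ-δˡ n i f)

  infixl 7 _·_
  _·_ : ∀ {k n m} → Matrix c k n → Matrix c n m → Matrix c k m
  _·_ {n = n} M N i j = Σ[ n ] (λ r → M i r *R N r j)

  ·-cong : ∀ {k n m} {M M' : Matrix c k n} {N N' : Matrix c n m} → M ≋ M' → N ≋ N' → M · N ≋ M' · N'
  ·-cong {n = n} M≋M' N≋N' i j = Σ-cong n (λ r → cong₂ _*R_ (M≋M' i r) (N≋N' r j))

  ·-assoc : ∀ {k n m p} (L : Matrix c k n) (M : Matrix c n m) (N : Matrix c m p) → (L · M) · N ≋ L · (M · N)
  ·-assoc {n = n} {m = m} L M N i j = begin
    Σ[ m ] (λ s → Σ[ n ] (λ r → L i r *R M r s) *R N s j)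
      ≡⟨ Σ-cong m (λ s → *R-distribʳ-Σ n (N s j) _) ⟩
    Σ[ m ] (λ s → Σ[ n ] (λ r → L i r *R M r s *R N s j))
      ≡⟨ Σ-comm m n _ ⟩
    Σ[ n ] (λ r → Σ[ m ] (λ s → L i r *R M r s *R N s j))
      ≡⟨ Σ-cong n (λ r → trans (Σ-cong m (λ s → *R-assoc _ _ _)) (sym (*R-distribˡ-Σ m (L i r) _))) ⟩
    Σ[ n ] (λ r → L i r *R Σ[ m ] (λ s → M r s *R N s j)) ∎
    where open ≡-Reasoning

  ·-identityˡ : ∀ {n m} (M : Matrix c n m) → δ · M ≋ M
  ·-identityˡ {n} M i j = Σ-δˡ n i (λ r → M r j)

  conj-· : ∀ {k n m} (M : Matrix c k n) (N : Matrix c n m) → conjugate (M · N) ≋ conjugate M · conjugate N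
  conj-· {n = n} M N i j = trans (conj-Σ n _) (Σ-cong n (λ r → conj-* (M i r) (N r j)))

  ·-transpose : ∀ {k n m} (M : Matrix c k n) (N : Matrix c n m) → (M · N) ᵀ ≋ N ᵀ · M ᵀ
  ·-transpose {n = n} M N i j = Σ-cong n (λ r → *R-comm (M j r) (N r i))

  ᴴ-· : ∀ {k n m} (M : Matrix c k n) (N : Matrix c n m) → (M · N) ᴴ ≋ N ᴴ · M ᴴ
  ᴴ-· {n = n} M N i j = trans (conj-Σ n _) (Σ-cong n (λ r → trans (conj-* (M j r) (N r i)) (*R-comm _ _)))

  δᴴ : ∀ {n} → δ {n = n} ᴴ ≋ δ
  δᴴ i j = trans (conj-δ j i) (δ-sym j i)

  stack : ∀ {k m n} → Matrix c k n → Matrix c m n → Matrix c (k ℕ.+ m) n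
  stack {k} X Y r = [ X , Y ]′ (splitAt k r)

  stack-↑ˡ : ∀ {k m n} (X : Matrix c k n) (Y : Matrix c m n) i s → stack X Y (i ↑ˡ m) s ≡ X i s
  stack-↑ˡ {k} {m} X Y i s rewrite Finₚ.splitAt-↑ˡ k i m = refl

  stack-↑ʳ : ∀ {k m n} (X : Matrix c k n) (Y : Matrix c m n) l s → stack X Y (k ↑ʳ l) s ≡ Y l s
  stack-↑ʳ {k} {m} X Y l s rewrite Finₚ.splitAt-↑ʳ k m l = refl

-- Multilinear alternating forms and determinants

module _ {c : Case} where
  open R-Solver c

  Extensional : ∀ {k m} → (Matrix c k m → R c) → Set
  Extensional F = ∀ {X Y} → X ≋ Y → F X ≡ F Y

  LinearInRow : ∀ {k m} → (Matrix c k m → R c) → Fin k → Set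
  LinearInRow {k} {m} F i = ∀ (X Y Z : Matrix c k m) (a : R c) →
    (∀ s → X i s ≡ a *R Y i s +R Z i s) →
    (∀ r → r ≢ i → ∀ s → X r s ≡ Y r s) →
    (∀ r → r ≢ i → ∀ s → X r s ≡ Z r s) → F X ≡ a *R F Y +R F Z

  Multilinear : ∀ {k m} → (Matrix c k m → R c) → Set
  Multilinear F = ∀ i → LinearInRow F i

  Alternating : ∀ {k m} → (Matrix c k m → R c) → Set
  Alternating {k} {m} F = ∀ (X : Matrix c k m) i j → i ≢ j → (∀ s → X i s ≡ X j s) → F X ≡ 0R

  module _ {k m : ℕ} {F : Matrix c k m → R c} where

    linear-zeroRow : ∀ {i} → LinearInRow F i → ∀ X → (∀ s → X i s ≡ 0R) → F X ≡ 0R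
    linear-zeroRow {i} lin X Xi≡0 = begin
      F X                       ≡⟨ solve 1 (λ x → x := (con (+ 1) :* x :+ x) :- x) refl (F X) ⟩
      (1R *R F X +R F X) -R F X ≡⟨ cong (_-R F X) (lin X X X 1R row (λ _ _ _ → refl) (λ _ _ _ → refl)) ⟨
      F X -R F X                ≡⟨ +R-inverseʳ (F X) ⟩
      0R                        ∎
      where
      open ≡-Reasoning
      row : ∀ s → X i s ≡ 1R *R X i s +R X i s
      row s = trans (Xi≡0 s) (sym (trans (cong (λ x → 1R *R x +R x) (Xi≡0 s))
                (solve 0 (con (+ 1) :* con (+ 0) :+ con (+ 0) := con (+ 0)) refl)))

    additive-in-row : ∀ {i} → LinearInRow F i → ∀ X Y Z →
      (∀ s → X i s ≡ Y i s +R Z i s) →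
      (∀ r → r ≢ i → ∀ s → X r s ≡ Y r s) →
      (∀ r → r ≢ i → ∀ s → X r s ≡ Z r s) → F X ≡ F Y +R F Z
    additive-in-row lin X Y Z row X≡Y X≡Z =
      trans (lin X Y Z 1R (λ s → trans (row s) (cong (_+R Z _ s) (sym (*R-identityˡ _)))) X≡Y X≡Z)
            (cong (_+R F Z) (*R-identityˡ (F Y)))

    linear-ΣRow : Extensional F → ∀ {i} → LinearInRow F i →
      ∀ n X (a : Fin n → R c) (v : Fin n → Fin m → R c) →
      (∀ s → X i s ≡ Σ[ n ] (λ r → a r *R v r s)) →
      F X ≡ Σ[ n ] (λ r → a r *R F (setRow X i (v r)))
    linear-ΣRow ext lin zero X a v row = linear-zeroRow lin X row
    linear-ΣRow ext {i} lin (suc n) X a v row = begin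
      F X
        ≡⟨ lin X (setRow X i (v zero)) X' (a zero) row-split (off-i (v zero)) (off-i _) ⟩
      a zero *R F (setRow X i (v zero)) +R F X'
        ≡⟨ cong (a zero *R F (setRow X i (v zero)) +R_)
             (linear-ΣRow ext lin n X' (a ∘ suc) (v ∘ suc) (λ s → cong (λ f → f s) (setRow-updates X i _))) ⟩
      a zero *R F (setRow X i (v zero)) +R Σ[ n ] (λ r → a (suc r) *R F (setRow X' i (v (suc r))))
        ≡⟨ cong (a zero *R F (setRow X i (v zero)) +R_)
             (Σ-cong n (λ r → cong (a (suc r) *R_) (ext (reset (v (suc r)))))) ⟩
      Σ[ suc n ] (λ r → a r *R F (setRow X i (v r))) ∎
      where
      open ≡-Reasoning
      X' = setRow X i (λ s → Σ[ n ] (λ r → a (suc r) *R v (suc r) s))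
      row-split : ∀ s → X i s ≡ a zero *R setRow X i (v zero) i s +R X' i s
      row-split s = trans (row s) (sym (cong₂ (λ u w → a zero *R u s +R w s)
                                          (setRow-updates X i (v zero)) (setRow-updates X i _)))
      off-i : ∀ u r → r ≢ i → ∀ s → X r s ≡ setRow X i u r s
      off-i u r r≢i s = sym (cong (λ f → f s) (setRow-minimal X i u r r≢i))
      reset : ∀ u → setRow X' i u ≋ setRow X i u
      reset u r s = cong (λ f → f s) (setRow-setRow X i _ u r)

    -- Expand F(M (X i + X j) (X i + X j)) = 0 by additivity in rows i and j, where M u v
    -- is X with rows i, j replaced by u, v; the two diagonal terms vanish.
    antisymmetric : Extensional F → Multilinear F → Alternating F →
      ∀ (X Y : Matrix c k m) i j → i ≢ j →
      (∀ s → Y i s ≡ X j s) → (∀ s → Y j s ≡ X i s) → (∀ r → r ≢ i → r ≢ j → ∀ s → Y r s ≡ X r s) →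
      F X +R F Y ≡ 0R
    antisymmetric ext lin alt X Y i j i≢j Yi Yj Yr = begin
      F X +R F Y
        ≡⟨ solve 2 (λ x y → x :+ y := (con (+ 0) :+ x) :+ (y :+ con (+ 0))) refl (F X) (F Y) ⟩
      (0R +R F X) +R (F Y +R 0R)
        ≡⟨ cong₂ (λ u v → (u +R F X) +R (F Y +R v)) (sym (diagonal (X i))) (sym (diagonal (X j))) ⟩
      (F (M (X i) (X i)) +R F X) +R (F Y +R F (M (X j) (X j)))
        ≡⟨ cong₂ (λ u v → (F (M (X i) (X i)) +R u) +R (v +R F (M (X j) (X j)))) (ext M≋X) (ext M≋Y) ⟨
      (F (M (X i) (X i)) +R F (M (X i) (X j))) +R (F (M (X j) (X i)) +R F (M (X j) (X j)))
        ≡⟨ cong₂ _+R_ (split-j (X i)) (split-j (X j)) ⟨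
      F (M (X i) W) +R F (M (X j) W)
        ≡⟨ additive-in-row (lin i) (M W W) (M (X i) W) (M (X j) W)
             (λ s → trans (M-i W W s) (sym (cong₂ _+R_ (M-i (X i) W s) (M-i (X j) W s))))
             (M-off-i W (X i) W) (M-off-i W (X j) W) ⟨
      F (M W W)
        ≡⟨ diagonal W ⟩
      0R ∎
      where
      open ≡-Reasoning
      W : Fin m → R c
      W s = X i s +R X j s
      M : (Fin m → R c) → (Fin m → R c) → Matrix c k m
      M u v = setRows X i u j v
      M-i : ∀ u v s → M u v i s ≡ u s
      M-i u v s = cong (λ f → f s) (setRows-i X i u j v i≢j)
      M-j : ∀ u v s → M u v j s ≡ v s
      M-j u v s = cong (λ f → f s) (setRows-j X i u j v)
      M-other : ∀ u v r → r ≢ i → r ≢ j → ∀ s → M u v r s ≡ X r s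
      M-other u v r r≢i r≢j s = cong (λ f → f s) (setRows-other X i u j v r r≢i r≢j)
      M-off-i : ∀ u u' v r → r ≢ i → ∀ s → M u v r s ≡ M u' v r s
      M-off-i u u' v r r≢i s = cong (λ f → f s) (setRows-offˡ X i u u' j v r r≢i)
      M-off-j : ∀ u v v' r → r ≢ j → ∀ s → M u v r s ≡ M u v' r s
      M-off-j u v v' r r≢j s = cong (λ f → f s) (setRows-offʳ X i u j v v' r r≢j)
      diagonal : ∀ u → F (M u u) ≡ 0R
      diagonal u = alt (M u u) i j i≢j (λ s → trans (M-i u u s) (sym (M-j u u s)))
      M≋X : M (X i) (X j) ≋ X
      M≋X r s = cong (λ f → f s) (setRows-self X i j r)
      M≋Y : M (X j) (X i) ≋ Y
      M≋Y r s with r Finₚ.≟ i | r Finₚ.≟ j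
      ... | yes refl | _ = trans (M-i (X j) (X i) s) (sym (Yi s))
      ... | no _ | yes refl = trans (M-j (X j) (X i) s) (sym (Yj s))
      ... | no r≢i | no r≢j = trans (M-other (X j) (X i) r r≢i r≢j s) (sym (Yr r r≢i r≢j s))
      split-j : ∀ u → F (M u W) ≡ F (M u (X i)) +R F (M u (X j))
      split-j u = additive-in-row (lin j) (M u W) (M u (X i)) (M u (X j))
        (λ s → trans (M-j u W s) (sym (cong₂ _+R_ (M-j u (X i) s) (M-j u (X j) s))))
        (M-off-j u W (X i)) (M-off-j u W (X j))

  module _ {k m : ℕ} (F : Matrix c (suc k) m → R c) (v : Fin m → R c) where

    ∷-extensional : Extensional F → Extensional (F ∘ (v ∷_))
    ∷-extensional ext Y≋Y' = ext λ { zero s → refl ; (suc i) s → Y≋Y' i s }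

    ∷-multilinear : Multilinear F → Multilinear (F ∘ (v ∷_))
    ∷-multilinear lin i X Y Z a row X≡Y X≡Z = lin (suc i) (v ∷ X) (v ∷ Y) (v ∷ Z) a row (lift X≡Y) (lift X≡Z)
      where
      lift : ∀ {W} → (∀ r → r ≢ i → ∀ s → X r s ≡ W r s) → ∀ r → r ≢ suc i → ∀ s → (v ∷ X) r s ≡ (v ∷ W) r s
      lift X≡W zero _ s = refl
      lift X≡W (suc r) r≢i s = X≡W r (r≢i ∘ cong suc) s

    ∷-alternating : Alternating F → Alternating (F ∘ (v ∷_))
    ∷-alternating alt X i j i≢j = alt (v ∷ X) (suc i) (suc j) (i≢j ∘ Finₚ.suc-injective)

  record IsIdeal (P : R c → Set) : Set where
    field
      0R∈ : P 0R
      +R∈ : ∀ {x y} → P x → P y → P (x +R y)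
      *R∈ : ∀ a {x} → P x → P (a *R x)

    -R∈ : ∀ {x} → P x → P (-R x)
    -R∈ {x} x∈ = subst P (trans (sym (-R-distribˡ-* 1R x)) (cong (-R_) (*R-identityˡ x))) (*R∈ (-R 1R) x∈)

    Σ∈ : ∀ n (t : Fin n → R c) → (∀ r → P (t r)) → P (Σ[ n ] t)
    Σ∈ zero t t∈ = 0R∈
    Σ∈ (suc n) t t∈ = +R∈ (t∈ zero) (Σ∈ n (t ∘ suc) (t∈ ∘ suc))

  ≡0R-isIdeal : IsIdeal (_≡ 0R)
  ≡0R-isIdeal = record
    { 0R∈ = refl
    ; +R∈ = λ x≡0 y≡0 → trans (cong₂ _+R_ x≡0 y≡0) (+R-identityˡ 0R)
    ; *R∈ = λ a x≡0 → trans (cong (a *R_) x≡0) (*R-zeroʳ a) }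

  ∣R-isIdeal : ∀ g → IsIdeal (g ∣R_)
  ∣R-isIdeal g = record
    { 0R∈ = 0R , sym (*R-zeroˡ g)
    ; +R∈ = λ { (q , x≡qg) (q' , y≡q'g) → q +R q' , trans (cong₂ _+R_ x≡qg y≡q'g) (sym (*R-distribʳ g q q')) }
    ; *R∈ = λ { a (q , x≡qg) → a *R q , trans (cong (a *R_) x≡qg) (sym (*R-assoc a q g)) } }

  module _ {P : R c → Set} (ideal : IsIdeal P) where
    open IsIdeal ideal

    -- A weak Cauchy–Binet: expanding F(C · A) row by row reaches only row selections of A.
    multilinear-∈ : ∀ k {m n} {F : Matrix c k m → R c} → Extensional F → Multilinear F →
      (A : Matrix c n m) → (∀ (f : Fin k → Fin n) → P (F (A ∘ f))) → ∀ (C : Matrix c k n) → P (F (C · A))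
    multilinear-∈ zero ext lin A A∘f∈ C = subst P (ext (λ ())) (A∘f∈ (λ ()))
    multilinear-∈ (suc k) {n = n} {F} ext lin A A∘f∈ C =
      subst P (sym expand) (Σ∈ n _ (λ r → *R∈ (C zero r) (subst P (ext (first-row r)) (IH r))))
      where
      expand : F (C · A) ≡ Σ[ n ] (λ r → C zero r *R F (setRow (C · A) zero (A r)))
      expand = linear-ΣRow ext (lin zero) n (C · A) (C zero) A (λ s → refl)
      first-row : ∀ r → (A r ∷ (C ∘ suc) · A) ≋ setRow (C · A) zero (A r)
      first-row r zero s = sym (cong (λ f → f s) (setRow-updates (C · A) zero (A r)))
      first-row r (suc i) s = sym (cong (λ f → f s) (setRow-minimal (C · A) zero (A r) (suc i) (λ ())))
      IH : ∀ r → P (F (A r ∷ (C ∘ suc) · A))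
      IH r = multilinear-∈ k (∷-extensional F (A r) ext) (∷-multilinear F (A r) lin) A
        (λ g → subst P (ext (λ { zero s → refl ; (suc i) s → refl })) (A∘f∈ (r ∷ g))) (C ∘ suc)

    -- A row selection either repeats a row, where F vanishes, or is an increasing one up to
    -- a permutation, which changes F by a sign; the sorting goes by induction on the rows of A.
    mutual
      ∈-increasing⇒∈ : ∀ n {k m} {F : Matrix c k m → R c} → Extensional F → Multilinear F → Alternating F →
        (A : Matrix c n m) → (∀ s → IncreasingRows n k s → P (F (A ∘ s))) → ∀ f → P (F (A ∘ f))
      ∈-increasing⇒∈ zero {zero} ext lin alt A A∘s∈ f = A∘s∈ f (λ ())
      ∈-increasing⇒∈ zero {suc k} ext lin alt A A∘s∈ f with f zero
      ... | ()
      ∈-increasing⇒∈ (suc n) ext lin alt A A∘s∈ f with Finₚ.any? (λ p → f p Finₚ.≟ zero)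
      ... | no f≢0 = subst P (ext (λ i s → cong (λ x → A x s) (Finₚ.punchIn-punchOut (0≢f i))))
          (∈-increasing⇒∈ n ext lin alt (A ∘ suc)
            (λ s s↑ → A∘s∈ (suc ∘ s) (λ i j i<j → s≤s (s↑ i j i<j))) (λ i → Fin.punchOut (0≢f i)))
        where
        0≢f : ∀ i → zero ≢ f i
        0≢f i 0≡fi = f≢0 (i , sym 0≡fi)
      ... | yes (p , fp≡0) with Finₚ.any? (λ q → ¬? (q Finₚ.≟ p) ×-dec (f q Finₚ.≟ zero))
      ...   | yes (q , q≢p , fq≡0) =
                subst P (sym (alt (A ∘ f) q p q≢p (λ s → cong (λ x → A x s) (trans fq≡0 (sym fp≡0))))) 0R∈
      ...   | no ¬twice =
                ∈-increasing⇒∈-zeroOnce ext lin alt A A∘s∈ f p fp≡0 (λ q q≢p fq≡0 → ¬twice (q , q≢p , fq≡0))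

      ∈-increasing⇒∈-zeroOnce : ∀ {n k m} {F : Matrix c k m → R c} → Extensional F → Multilinear F → Alternating F →
        (A : Matrix c (suc n) m) → (∀ s → IncreasingRows (suc n) k s → P (F (A ∘ s))) →
        ∀ f p → f p ≡ zero → (∀ q → q ≢ p → f q ≢ zero) → P (F (A ∘ f))
      ∈-increasing⇒∈-zeroOnce {k = suc k} ext lin alt A A∘s∈ f zero f0≡0 once =
        ∈-increasing⇒∈-zeroFirst ext lin alt A A∘s∈ f f0≡0 (λ i → once (suc i) (λ ()))
      ∈-increasing⇒∈-zeroOnce {k = suc k} {F = F} ext lin alt A A∘s∈ f (suc p) fp≡0 once =
        subst P (sym F[A∘f]≡-F[A∘f']) (-R∈ (∈-increasing⇒∈-zeroFirst ext lin alt A A∘s∈ f' f'0≡0 f'≢0))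
        where
        f' = setRows f zero (f (suc p)) (suc p) (f zero)
        f'0≡0 : f' zero ≡ zero
        f'0≡0 = trans (setRows-i f zero (f (suc p)) (suc p) (f zero) (λ ())) fp≡0
        f'≢0 : ∀ i → f' (suc i) ≢ zero
        f'≢0 i with suc i Finₚ.≟ suc p
        ... | yes refl = once zero (λ ()) ∘ trans (sym (setRows-j f zero (f (suc p)) (suc p) (f zero)))
        ... | no i≢p = once (suc i) i≢p ∘ trans (sym (setRows-other f zero (f (suc p)) (suc p) (f zero) (suc i) (λ ()) i≢p))
        F[A∘f]≡-F[A∘f'] : F (A ∘ f) ≡ -R F (A ∘ f')
        F[A∘f]≡-F[A∘f'] = x+y≡0⇒x≡-y _ _ (antisymmetric ext lin alt (A ∘ f) (A ∘ f') zero (suc p) (λ ())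
          (λ s → cong (λ x → A x s) (trans f'0≡0 (sym fp≡0)))
          (λ s → cong (λ x → A x s) (setRows-j f zero (f (suc p)) (suc p) (f zero)))
          (λ r r≢0 r≢p s → cong (λ x → A x s) (setRows-other f zero (f (suc p)) (suc p) (f zero) r r≢0 r≢p)))

      ∈-increasing⇒∈-zeroFirst : ∀ {n k m} {F : Matrix c (suc k) m → R c} →
        Extensional F → Multilinear F → Alternating F →
        (A : Matrix c (suc n) m) → (∀ s → IncreasingRows (suc n) (suc k) s → P (F (A ∘ s))) →
        ∀ f → f zero ≡ zero → (∀ i → f (suc i) ≢ zero) → P (F (A ∘ f))
      ∈-increasing⇒∈-zeroFirst {n} {k} {F = F} ext lin alt A A∘s∈ f f0≡0 f≢0 =
        subst P (ext restore) (∈-increasing⇒∈ n (∷-extensional F (A zero) ext) (∷-multilinear F (A zero) lin)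
          (∷-alternating F (A zero) alt) (A ∘ suc) A∘s∈' (λ i → Fin.punchOut (0≢f i)))
        where
        0≢f : ∀ i → zero ≢ f (suc i)
        0≢f i = f≢0 i ∘ sym
        restore : (A zero ∷ (λ i → A (suc (Fin.punchOut (0≢f i))))) ≋ A ∘ f
        restore zero s = cong (λ x → A x s) (sym f0≡0)
        restore (suc i) s = cong (λ x → A x s) (Finₚ.punchIn-punchOut (0≢f i))
        lift↑ : ∀ (t : Fin k → Fin n) → IncreasingRows n k t → IncreasingRows (suc n) (suc k) (zero ∷ (suc ∘ t))
        lift↑ t t↑ zero (suc j) _ = s≤s z≤n
        lift↑ t t↑ (suc i) (suc j) (s≤s i<j) = s≤s (t↑ i j i<j)
        A∘s∈' : ∀ t → IncreasingRows n k t → P (F (A zero ∷ (A ∘ suc ∘ t)))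
        A∘s∈' t t↑ = subst P (ext (λ { zero s → refl ; (suc i) s → refl })) (A∘s∈ _ (lift↑ t t↑))

module _ {c : Case} where
  open R-Solver c

  sign-linearˡ : ∀ m (a x y d : R c) → sign m ((a *R x +R y) *R d) ≡ a *R sign m (x *R d) +R sign m (y *R d)
  sign-linearˡ m a x y d = begin
    sign m ((a *R x +R y) *R d)                    ≡⟨ sign≡sgn* m _ ⟩
    sgn m *R ((a *R x +R y) *R d)                  ≡⟨ solve 5 (λ g a x y d → g :* ((a :* x :+ y) :* d) := a :* (g :* (x :* d)) :+ g :* (y :* d)) refl (sgn m) a x y d ⟩
    a *R (sgn m *R (x *R d)) +R sgn m *R (y *R d)  ≡⟨ cong₂ (λ u v → a *R u +R v) (sign≡sgn* m _) (sign≡sgn* m _) ⟨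
    a *R sign m (x *R d) +R sign m (y *R d)        ∎
    where open ≡-Reasoning

  sign-linearʳ : ∀ m (a x d e : R c) → sign m (x *R (a *R d +R e)) ≡ a *R sign m (x *R d) +R sign m (x *R e)
  sign-linearʳ m a x d e = begin
    sign m (x *R (a *R d +R e))                    ≡⟨ sign≡sgn* m _ ⟩
    sgn m *R (x *R (a *R d +R e))                  ≡⟨ solve 5 (λ g a x d e → g :* (x :* (a :* d :+ e)) := a :* (g :* (x :* d)) :+ g :* (x :* e)) refl (sgn m) a x d e ⟩
    a *R (sgn m *R (x *R d)) +R sgn m *R (x *R e)  ≡⟨ cong₂ (λ u v → a *R u +R v) (sign≡sgn* m _) (sign≡sgn* m _) ⟨
    a *R sign m (x *R d) +R sign m (x *R e)        ∎
    where open ≡-Reasoning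

  sign-*0R : ∀ m (x : R c) → sign m (x *R 0R) ≡ 0R
  sign-*0R m x = trans (cong (sign m) (*R-zeroʳ x)) (sign-0R m)

  sign-0R* : ∀ m (x : R c) → sign m (0R *R x) ≡ 0R
  sign-0R* m x = trans (cong (sign m) (*R-zeroˡ x)) (sign-0R m)

  Σ-linear : ∀ n (a : R c) (f g h : Fin n → R c) → (∀ j → f j ≡ a *R g j +R h j) →
    Σ[ n ] f ≡ a *R Σ[ n ] g +R Σ[ n ] h
  Σ-linear n a f g h f≗ag+h =
    trans (Σ-cong n f≗ag+h) (trans (Σ-distrib-+ n _ _) (cong (_+R Σ[ n ] h) (sym (*R-distribˡ-Σ n a g))))

  det-extensional : ∀ n → Extensional (det {c} n)
  det-extensional zero _ = refl
  det-extensional (suc n) M≋N = Σ-cong (suc n) (λ j → cong (sign (toℕ j))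
    (cong₂ _*R_ (M≋N zero j) (det-extensional n (λ r s → M≋N (suc r) (punchIn j s)))))

  det-δ : ∀ n → det {c} n δ ≡ 1R
  det-δ zero = refl
  det-δ (suc n) = trans
    (cong₂ _+R_ (trans (*R-identityˡ _) (det-δ n)) (Σ-zero n (λ j → sign-0R* (toℕ (suc j)) _)))
    (+R-identityʳ 1R)

  det-multilinear : ∀ n → Multilinear (det {c} n)
  det-multilinear (suc n) zero X Y Z a row X≡Y X≡Z = Σ-linear (suc n) a _ _ _ (λ j → begin
    sign (toℕ j) (X zero j *R det n (firstRowMinor X j))
      ≡⟨ cong₂ (λ u v → sign (toℕ j) (u *R v)) (row j) (det-extensional n (minor≋ X≡Y j)) ⟩
    sign (toℕ j) ((a *R Y zero j +R Z zero j) *R det n (firstRowMinor Y j))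
      ≡⟨ sign-linearˡ (toℕ j) a _ _ _ ⟩
    a *R sign (toℕ j) (Y zero j *R det n (firstRowMinor Y j)) +R sign (toℕ j) (Z zero j *R det n (firstRowMinor Y j))
      ≡⟨ cong (λ d → a *R _ +R sign (toℕ j) (Z zero j *R d)) (det-extensional n (λ r s → trans (sym (minor≋ X≡Y j r s)) (minor≋ X≡Z j r s))) ⟩
    a *R sign (toℕ j) (Y zero j *R det n (firstRowMinor Y j)) +R sign (toℕ j) (Z zero j *R det n (firstRowMinor Z j)) ∎)
    where
    open ≡-Reasoning
    minor≋ : ∀ {W} → (∀ r → r ≢ zero → ∀ s → X r s ≡ W r s) → ∀ j → firstRowMinor X j ≋ firstRowMinor W j
    minor≋ X≡W j r s = X≡W (suc r) (λ ()) (punchIn j s)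
  det-multilinear (suc n) (suc i) X Y Z a row X≡Y X≡Z = Σ-linear (suc n) a _ _ _ (λ j → begin
    sign (toℕ j) (X zero j *R det n (firstRowMinor X j))
      ≡⟨ cong₂ (λ u v → sign (toℕ j) (u *R v)) (X≡Y zero (λ ()) j)
           (det-multilinear n i (firstRowMinor X j) (firstRowMinor Y j) (firstRowMinor Z j) a (row ∘ punchIn j)
              (minor≡ X≡Y j) (minor≡ X≡Z j)) ⟩
    sign (toℕ j) (Y zero j *R (a *R det n (firstRowMinor Y j) +R det n (firstRowMinor Z j)))
      ≡⟨ sign-linearʳ (toℕ j) a _ _ _ ⟩
    a *R sign (toℕ j) (Y zero j *R det n (firstRowMinor Y j)) +R sign (toℕ j) (Y zero j *R det n (firstRowMinor Z j))
      ≡⟨ cong (λ u → a *R _ +R sign (toℕ j) (u *R det n (firstRowMinor Z j))) (trans (sym (X≡Y zero (λ ()) j)) (X≡Z zero (λ ()) j)) ⟩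
    a *R sign (toℕ j) (Y zero j *R det n (firstRowMinor Y j)) +R sign (toℕ j) (Z zero j *R det n (firstRowMinor Z j)) ∎)
    where
    open ≡-Reasoning
    minor≡ : ∀ {W} → (∀ r → r ≢ suc i → ∀ s → X r s ≡ W r s) → ∀ j r → r ≢ i → ∀ s →
      firstRowMinor X j r s ≡ firstRowMinor W j r s
    minor≡ X≡W j r r≢i s = X≡W (suc r) (r≢i ∘ Finₚ.suc-injective) (punchIn j s)

  -- Expanding det along two equal first rows a: row 0 takes column j and row 1 takes
  -- column punchIn j l; G is the determinant of the remaining rows on the remaining columns.
  doubleExpansionTerm : ∀ p → (Fin (2 ℕ.+ p) → R c) → ((Fin p → Fin (2 ℕ.+ p)) → R c) →
    Fin (2 ℕ.+ p) → Fin (suc p) → R c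
  doubleExpansionTerm p a G j l =
    sgn (toℕ j) *R (sgn (toℕ l) *R (a j *R (a (punchIn j l) *R G (punchIn j ∘ punchIn l))))

  doubleExpansionTerm-suc : ∀ p (a : Fin (3 ℕ.+ p) → R c) (G : (Fin (suc p) → Fin (3 ℕ.+ p)) → R c) →
    (∀ {h h'} → (∀ s → h s ≡ h' s) → G h ≡ G h') → ∀ j l →
    doubleExpansionTerm (suc p) a G (suc j) (suc l) ≡ doubleExpansionTerm p (a ∘ suc) (λ h → G (zero ∷ (suc ∘ h))) j l
  doubleExpansionTerm-suc p a G G-ext j l = begin
    sgn (toℕ (suc j)) *R (sgn (toℕ (suc l)) *R (x *R (y *R g)))
      ≡⟨ cong₂ (λ u v → u *R (v *R (x *R (y *R g)))) (sgn-suc (toℕ j)) (sgn-suc (toℕ l)) ⟩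
    (-R sgn (toℕ j)) *R ((-R sgn (toℕ l)) *R (x *R (y *R g)))
      ≡⟨ solve 5 (λ u v x y g → (:- u) :* ((:- v) :* (x :* (y :* g))) := u :* (v :* (x :* (y :* g))))
               refl (sgn (toℕ j)) (sgn (toℕ l)) x y g ⟩
    sgn (toℕ j) *R (sgn (toℕ l) *R (x *R (y *R g)))
      ≡⟨ cong (λ g → sgn (toℕ j) *R (sgn (toℕ l) *R (x *R (y *R g)))) (G-ext (λ { zero → refl ; (suc s) → refl })) ⟩
    doubleExpansionTerm p (a ∘ suc) (λ h → G (zero ∷ (suc ∘ h))) j l ∎
    where
    open ≡-Reasoning
    x = a (suc j)
    y = a (suc (punchIn j l))
    g = G (punchIn (suc j) ∘ punchIn (suc l))

  -- The term (j, l) cancels against the one choosing the same two columns in the other order.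
  doubleExpansion-vanishes : ∀ p (a : Fin (2 ℕ.+ p) → R c) (G : (Fin p → Fin (2 ℕ.+ p)) → R c) →
    (∀ {h h'} → (∀ s → h s ≡ h' s) → G h ≡ G h') →
    Σ[ 2 ℕ.+ p ] (λ j → Σ[ suc p ] (λ l → doubleExpansionTerm p a G j l)) ≡ 0R
  doubleExpansion-vanishes zero a G G-ext =
    trans (cong₂ (λ g g' → (1R *R (1R *R (a zero *R (a (suc zero) *R g))) +R 0R)
                           +R (((-R 1R) *R (1R *R (a (suc zero) *R (a zero *R g'))) +R 0R) +R 0R))
                 (G-ext (λ ())) (G-ext (λ ())))
      (solve 3 (λ x y g → (con (+ 1) :* (con (+ 1) :* (x :* (y :* g))) :+ con (+ 0)) :+
                          (((:- con (+ 1)) :* (con (+ 1) :* (y :* (x :* g))) :+ con (+ 0)) :+ con (+ 0)) := con (+ 0))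
             refl (a zero) (a (suc zero)) (G (λ ())))
  doubleExpansion-vanishes (suc p) a G G-ext = begin
    (E₀₀ +R top) +R Σ[ 2 ℕ.+ p ] (λ j → E (suc j) zero +R Σ[ suc p ] (λ l → E (suc j) (suc l)))
      ≡⟨ cong ((E₀₀ +R top) +R_) (Σ-distrib-+ (2 ℕ.+ p) (λ j → E (suc j) zero) (λ j → Σ[ suc p ] (λ l → E (suc j) (suc l)))) ⟩
    (E₀₀ +R top) +R ((E₁₀ +R left) +R rest)
      ≡⟨ cong (λ t → (E₀₀ +R top) +R ((E₁₀ +R left) +R t)) interior ⟩
    (E₀₀ +R top) +R ((E₁₀ +R left) +R 0R)
      ≡⟨ solve 4 (λ x a y b → (x :+ a) :+ ((y :+ b) :+ con (+ 0)) := (x :+ y) :+ (a :+ b)) refl E₀₀ top E₁₀ left ⟩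
    (E₀₀ +R E₁₀) +R (top +R left)
      ≡⟨ cong₂ _+R_ corner (trans (sym (Σ-distrib-+ (suc p) (λ l → E zero (suc l)) (λ l → E (2+ l) zero))) (Σ-zero (suc p) edge)) ⟩
    0R +R 0R ≡⟨ +R-identityˡ 0R ⟩
    0R ∎
    where
    open ≡-Reasoning
    E = doubleExpansionTerm (suc p) a G
    2+ : Fin (suc p) → Fin (2 ℕ.+ suc p)
    2+ l = suc (suc l)
    E₀₀ = E zero zero
    E₁₀ = E (suc zero) zero
    top = Σ[ suc p ] (λ l → E zero (suc l))
    left = Σ[ suc p ] (λ l → E (2+ l) zero)
    rest = Σ[ 2 ℕ.+ p ] (λ j → Σ[ suc p ] (λ l → E (suc j) (suc l)))
    corner : E₀₀ +R E₁₀ ≡ 0R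
    corner = solve 3 (λ x y g → con (+ 1) :* (con (+ 1) :* (x :* (y :* g))) :+ (:- con (+ 1)) :* (con (+ 1) :* (y :* (x :* g))) := con (+ 0))
                     refl (a zero) (a (suc zero)) (G (λ s → suc (suc s)))
    edge : ∀ l → E zero (suc l) +R E (2+ l) zero ≡ 0R
    edge l = trans (cong (λ u → 1R *R (u *R (a zero *R (a (2+ l) *R G (suc ∘ punchIn (suc l))))) +R E (2+ l) zero) (sgn-suc (toℕ l)))
      (solve 4 (λ g x y d → con (+ 1) :* ((:- g) :* (x :* (y :* d))) :+ g :* (con (+ 1) :* (y :* (x :* d))) := con (+ 0))
             refl (sgn (toℕ l)) (a zero) (a (2+ l)) (G (suc ∘ punchIn (suc l))))
    interior : rest ≡ 0R
    interior = trans (Σ-cong (2 ℕ.+ p) (λ j → Σ-cong (suc p) (doubleExpansionTerm-suc p a G G-ext j)))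
                     (doubleExpansion-vanishes p (a ∘ suc) (λ h → G (zero ∷ (suc ∘ h)))
                        (λ h≗h' → G-ext (λ { zero → refl ; (suc s) → cong suc (h≗h' s) })))

  det-rows01-equal : ∀ p (X : Matrix c (2 ℕ.+ p) (2 ℕ.+ p)) → (∀ s → X (suc zero) s ≡ X zero s) → det (2 ℕ.+ p) X ≡ 0R
  det-rows01-equal p X X₁≡X₀ =
    trans (Σ-cong (2 ℕ.+ p) expand) (doubleExpansion-vanishes p (X zero) G (λ h≗h' → det-extensional p (λ r s → cong (X (suc (suc r))) (h≗h' s))))
    where
    G : (Fin p → Fin (2 ℕ.+ p)) → R c
    G h = det p (λ r s → X (suc (suc r)) (h s))
    expand : ∀ j → sign (toℕ j) (X zero j *R det (suc p) (firstRowMinor X j))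
                 ≡ Σ[ suc p ] (doubleExpansionTerm p (X zero) G j)
    expand j = begin
      sign (toℕ j) (X zero j *R Σ[ suc p ] t)            ≡⟨ sign≡sgn* (toℕ j) _ ⟩
      sgn (toℕ j) *R (X zero j *R Σ[ suc p ] t)          ≡⟨ cong (sgn (toℕ j) *R_) (*R-distribˡ-Σ (suc p) (X zero j) t) ⟩
      sgn (toℕ j) *R Σ[ suc p ] (λ l → X zero j *R t l)  ≡⟨ *R-distribˡ-Σ (suc p) (sgn (toℕ j)) (λ l → X zero j *R t l) ⟩
      Σ[ suc p ] (λ l → sgn (toℕ j) *R (X zero j *R t l)) ≡⟨ Σ-cong (suc p) term ⟩
      Σ[ suc p ] (doubleExpansionTerm p (X zero) G j)     ∎
      where
      open ≡-Reasoning
      t : Fin (suc p) → R c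
      t l = sign (toℕ l) (X (suc zero) (punchIn j l) *R G (punchIn j ∘ punchIn l))
      term : ∀ l → sgn (toℕ j) *R (X zero j *R t l) ≡ doubleExpansionTerm p (X zero) G j l
      term l = trans (cong (λ u → sgn (toℕ j) *R (X zero j *R u))
                           (trans (sign≡sgn* (toℕ l) _)
                                  (cong (λ x → sgn (toℕ l) *R (x *R G (punchIn j ∘ punchIn l))) (X₁≡X₀ (punchIn j l)))))
        (solve 5 (λ g h x y d → g :* (x :* (h :* (y :* d))) := g :* (h :* (x :* (y :* d))))
               refl (sgn (toℕ j)) (sgn (toℕ l)) (X zero j) (X zero (punchIn j l)) (G (punchIn j ∘ punchIn l)))

  det-swapLowerRows : ∀ n → Alternating (det {c} n) →
    ∀ (X X' : Matrix c (suc n) (suc n)) (i j : Fin n) → i ≢ j →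
    (∀ s → X' zero s ≡ X zero s) → (∀ s → X' (suc i) s ≡ X (suc j) s) → (∀ s → X' (suc j) s ≡ X (suc i) s) →
    (∀ r → r ≢ i → r ≢ j → ∀ s → X' (suc r) s ≡ X (suc r) s) → det (suc n) X +R det (suc n) X' ≡ 0R
  det-swapLowerRows n alt X X' i j i≢j X'₀ X'i X'j X'r =
    trans (sym (Σ-distrib-+ (suc n) (λ l → term X l) (λ l → term X' l))) (Σ-zero (suc n) terms-cancel)
    where
    term : Matrix c (suc n) (suc n) → Fin (suc n) → R c
    term M l = sign (toℕ l) (M zero l *R det n (firstRowMinor M l))
    terms-cancel : ∀ l → term X l +R term X' l ≡ 0R
    terms-cancel l = begin
      sign (toℕ l) (X zero l *R d) +R sign (toℕ l) (X' zero l *R d')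
        ≡⟨ cong₂ _+R_ (sign≡sgn* (toℕ l) _) (trans (sign≡sgn* (toℕ l) _) (cong (λ x → sgn (toℕ l) *R (x *R d')) (X'₀ l))) ⟩
      sgn (toℕ l) *R (X zero l *R d) +R sgn (toℕ l) *R (X zero l *R d')
        ≡⟨ cong (λ u → sgn (toℕ l) *R (X zero l *R u) +R sgn (toℕ l) *R (X zero l *R d')) d≡-d' ⟩
      sgn (toℕ l) *R (X zero l *R (-R d')) +R sgn (toℕ l) *R (X zero l *R d')
        ≡⟨ solve 3 (λ g x d → g :* (x :* (:- d)) :+ g :* (x :* d) := con (+ 0)) refl (sgn (toℕ l)) (X zero l) d' ⟩
      0R ∎
      where
      open ≡-Reasoning
      d = det n (firstRowMinor X l)
      d' = det n (firstRowMinor X' l)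
      d≡-d' : d ≡ -R d'
      d≡-d' = x+y≡0⇒x≡-y d d' (antisymmetric (det-extensional n) (det-multilinear n) alt
        (firstRowMinor X l) (firstRowMinor X' l) i j i≢j
        (X'i ∘ punchIn l) (X'j ∘ punchIn l) (λ r r≢i r≢j → X'r r r≢i r≢j ∘ punchIn l))

  det-row0≡row : ∀ n → Alternating (det {c} n) → ∀ (X : Matrix c (suc n) (suc n)) q →
    (∀ s → X zero s ≡ X (suc q) s) → det (suc n) X ≡ 0R
  det-row0≡row (suc p) alt X zero X₀≡X₁ = det-rows01-equal p X (sym ∘ X₀≡X₁)
  det-row0≡row (suc p) alt X (suc q) X₀≡Xq = begin
    det (2 ℕ.+ p) X      ≡⟨ x+y≡0⇒x≡-y _ _ (det-swapLowerRows (suc p) alt X X' zero (suc q) (λ ())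
                              (X'-other zero (λ ()) (λ ())) X'-1 X'-2+q
                              (λ r r≢0 r≢q → X'-other (suc r) (r≢0 ∘ Finₚ.suc-injective) (r≢q ∘ Finₚ.suc-injective))) ⟩
    -R det (2 ℕ.+ p) X'  ≡⟨ cong (-R_) (det-rows01-equal p X' (λ s → trans (X'-1 s) (sym (trans (X'-other zero (λ ()) (λ ()) s) (X₀≡Xq s))))) ⟩
    -R 0R                ≡⟨ -R-0R ⟩
    0R                   ∎
    where
    open ≡-Reasoning
    X' = setRows X (suc zero) (X (suc (suc q))) (suc (suc q)) (X (suc zero))
    X'-1 : ∀ s → X' (suc zero) s ≡ X (suc (suc q)) s
    X'-1 s = cong (λ f → f s) (setRows-i X (suc zero) (X (suc (suc q))) (suc (suc q)) (X (suc zero)) (λ ()))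
    X'-2+q : ∀ s → X' (suc (suc q)) s ≡ X (suc zero) s
    X'-2+q s = cong (λ f → f s) (setRows-j X (suc zero) (X (suc (suc q))) (suc (suc q)) (X (suc zero)))
    X'-other : ∀ r → r ≢ suc zero → r ≢ suc (suc q) → ∀ s → X' r s ≡ X r s
    X'-other r r≢1 r≢2+q s = cong (λ f → f s) (setRows-other X (suc zero) (X (suc (suc q))) (suc (suc q)) (X (suc zero)) r r≢1 r≢2+q)

  det-alternating : ∀ n → Alternating (det {c} n)
  det-alternating (suc n) X zero zero 0≢0 _ = ⊥-elim (0≢0 refl)
  det-alternating (suc n) X zero (suc q) _ X₀≡Xq = det-row0≡row n (det-alternating n) X q X₀≡Xq
  det-alternating (suc n) X (suc q) zero _ Xq≡X₀ = det-row0≡row n (det-alternating n) X q (sym ∘ Xq≡X₀)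
  det-alternating (suc n) X (suc i) (suc j) i≢j Xi≡Xj = Σ-zero (suc n) (λ l →
    trans (cong (λ d → sign (toℕ l) (X zero l *R d))
                (det-alternating n (firstRowMinor X l) i j (i≢j ∘ cong suc) (Xi≡Xj ∘ punchIn l)))
          (sign-*0R (toℕ l) _))

increasing-lowerBound : ∀ a b (s : Fin (suc a) → Fin b) → IncreasingRows b (suc a) s →
  ∀ i → toℕ i ℕ.+ toℕ (s zero) ℕ.≤ toℕ (s i)
increasing-lowerBound a b s s↑ zero = ℕₚ.≤-refl
increasing-lowerBound (suc a) b s s↑ (suc i) = begin
  suc (toℕ i ℕ.+ toℕ (s zero))   ≡⟨ ℕₚ.+-suc (toℕ i) (toℕ (s zero)) ⟨
  toℕ i ℕ.+ suc (toℕ (s zero))   ≤⟨ ℕₚ.+-monoʳ-≤ (toℕ i) (s↑ zero (suc zero) (s≤s z≤n)) ⟩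
  toℕ i ℕ.+ toℕ (s (suc zero))   ≤⟨ increasing-lowerBound a b (s ∘ suc) (λ x y x<y → s↑ (suc x) (suc y) (s≤s x<y)) i ⟩
  toℕ (s (suc i))                ∎
  where open ℕₚ.≤-Reasoning

increasing⇒zero↦zero : ∀ n (s : Fin (suc n) → Fin (suc n)) → IncreasingRows (suc n) (suc n) s → s zero ≡ zero
increasing⇒zero↦zero n s s↑ = Finₚ.toℕ-injective (ℕₚ.n≤0⇒n≡0 (ℕₚ.+-cancelˡ-≤ n _ _ (begin
  n ℕ.+ toℕ (s zero)              ≡⟨ cong (ℕ._+ toℕ (s zero)) (Finₚ.toℕ-fromℕ n) ⟨
  toℕ (fromℕ n) ℕ.+ toℕ (s zero)  ≤⟨ increasing-lowerBound n (suc n) s s↑ (fromℕ n) ⟩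
  toℕ (s (fromℕ n))               ≤⟨ Finₚ.toℕ≤pred[n] (s (fromℕ n)) ⟩
  n                               ≡⟨ ℕₚ.+-identityʳ n ⟨
  n ℕ.+ 0                         ∎)))
  where open ℕₚ.≤-Reasoning

increasing⇒≗id : ∀ n (s : Fin n → Fin n) → IncreasingRows n n s → ∀ i → s i ≡ i
increasing⇒≗id (suc n) s s↑ zero = increasing⇒zero↦zero n s s↑
increasing⇒≗id (suc n) s s↑ (suc j) =
  trans (sym (Finₚ.punchIn-punchOut (0≢s∘suc j))) (cong suc (increasing⇒≗id n s' s'↑ j))
  where
  0≢s∘suc : ∀ j → zero ≢ s (suc j)
  0≢s∘suc j 0≡s[1+j] = ℕₚ.<-irrefl (cong toℕ (trans (increasing⇒zero↦zero n s s↑) 0≡s[1+j]))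
                                    (s↑ zero (suc j) (s≤s z≤n))
  s' : Fin n → Fin n
  s' j = Fin.punchOut (0≢s∘suc j)
  toℕ-s : ∀ j → toℕ (s (suc j)) ≡ suc (toℕ (s' j))
  toℕ-s j = sym (cong toℕ (Finₚ.punchIn-punchOut (0≢s∘suc j)))
  s'↑ : IncreasingRows n n s'
  s'↑ x y x<y = ℕₚ.≤-pred (subst₂ ℕ._<_ (toℕ-s x) (toℕ-s y) (s↑ (suc x) (suc y) (s≤s x<y)))

module _ {c : Case} where
  open R-Solver c

  private
    signedDoubleSum : ∀ n m (x : Fin n → R c) (y : Fin m → R c) (d : Fin n → Fin m → R c) →
      Σ[ n ] (λ j → sign (suc (toℕ j)) (x j *R Σ[ m ] (λ i → sign (toℕ i) (y i *R d j i))))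
      ≡ Σ[ n ] (λ j → Σ[ m ] (λ i → -R (sgn (toℕ j) *R sgn (toℕ i) *R (x j *R y i *R d j i))))
    signedDoubleSum n m x y d = Σ-cong n (λ j → begin
      sign (suc (toℕ j)) (x j *R Σ[ m ] (λ i → sign (toℕ i) (y i *R d j i)))
        ≡⟨ sign≡sgn* (suc (toℕ j)) _ ⟩
      sgn (suc (toℕ j)) *R (x j *R Σ[ m ] (λ i → sign (toℕ i) (y i *R d j i)))
        ≡⟨ cong (λ u → sgn (suc (toℕ j)) *R (x j *R u)) (Σ-cong m (λ i → sign≡sgn* (toℕ i) _)) ⟩
      sgn (suc (toℕ j)) *R (x j *R Σ[ m ] (λ i → sgn (toℕ i) *R (y i *R d j i)))
        ≡⟨ cong (sgn (suc (toℕ j)) *R_) (*R-distribˡ-Σ m (x j) _) ⟩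
      sgn (suc (toℕ j)) *R Σ[ m ] (λ i → x j *R (sgn (toℕ i) *R (y i *R d j i)))
        ≡⟨ *R-distribˡ-Σ m (sgn (suc (toℕ j))) _ ⟩
      Σ[ m ] (λ i → sgn (suc (toℕ j)) *R (x j *R (sgn (toℕ i) *R (y i *R d j i))))
        ≡⟨ Σ-cong m (λ i → trans (cong (λ g → g *R (x j *R (sgn (toℕ i) *R (y i *R d j i)))) (sgn-suc (toℕ j)))
             (solve 5 (λ g h a b e → (:- g) :* (a :* (h :* (b :* e))) := :- (g :* h :* (a :* b :* e)))
                    refl (sgn (toℕ j)) (sgn (toℕ i)) (x j) (y i) (d j i))) ⟩
      Σ[ m ] (λ i → -R (sgn (toℕ j) *R sgn (toℕ i) *R (x j *R y i *R d j i))) ∎)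
      where open ≡-Reasoning

  det-firstColumnExpansion : ∀ n (M : Matrix c (suc n) (suc n)) →
    det (suc n) M ≡ Σ[ suc n ] (λ i → sign (toℕ i) (M i zero *R det n (firstColumnMinor M i)))
  det-firstColumnExpansion zero M = refl
  det-firstColumnExpansion (suc n) M = cong (sign 0 (M zero zero *R det (suc n) (firstRowMinor M zero)) +R_) (begin
    Σ[ suc n ] (λ j → sign (toℕ (suc j)) (M zero (suc j) *R det (suc n) (firstRowMinor M (suc j))))
      ≡⟨ Σ-cong (suc n) (λ j → cong (λ u → sign (toℕ (suc j)) (M zero (suc j) *R u))
                                     (det-firstColumnExpansion n (firstRowMinor M (suc j)))) ⟩
    Σ[ suc n ] (λ j → sign (suc (toℕ j)) (M zero (suc j) *R Σ[ suc n ] (λ i → sign (toℕ i) (M (suc i) zero *R D i j))))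
      ≡⟨ signedDoubleSum (suc n) (suc n) (λ j → M zero (suc j)) (λ i → M (suc i) zero) (λ j i → D i j) ⟩
    Σ[ suc n ] (λ j → Σ[ suc n ] (λ i → -R (sgn (toℕ j) *R sgn (toℕ i) *R (M zero (suc j) *R M (suc i) zero *R D i j))))
      ≡⟨ Σ-comm (suc n) (suc n) (λ j i → -R (sgn (toℕ j) *R sgn (toℕ i) *R (M zero (suc j) *R M (suc i) zero *R D i j))) ⟩
    Σ[ suc n ] (λ i → Σ[ suc n ] (λ j → -R (sgn (toℕ j) *R sgn (toℕ i) *R (M zero (suc j) *R M (suc i) zero *R D i j))))
      ≡⟨ Σ-cong (suc n) (λ i → Σ-cong (suc n) (λ j →
           solve 5 (λ g h a b e → :- (g :* h :* (a :* b :* e)) := :- (h :* g :* (b :* a :* e)))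
                 refl (sgn (toℕ j)) (sgn (toℕ i)) (M zero (suc j)) (M (suc i) zero) (D i j))) ⟩
    Σ[ suc n ] (λ i → Σ[ suc n ] (λ j → -R (sgn (toℕ i) *R sgn (toℕ j) *R (M (suc i) zero *R M zero (suc j) *R D i j))))
      ≡⟨ signedDoubleSum (suc n) (suc n) (λ i → M (suc i) zero) (λ j → M zero (suc j)) D ⟨
    Σ[ suc n ] (λ i → sign (toℕ (suc i)) (M (suc i) zero *R det (suc n) (firstColumnMinor M (suc i)))) ∎)
    where
    open ≡-Reasoning
    D : Fin (suc n) → Fin (suc n) → R c
    D i j = det n (λ r s → M (suc (punchIn i r)) (suc (punchIn j s)))

  det-transpose : ∀ n (M : Matrix c n n) → det n (M ᵀ) ≡ det n M
  det-transpose zero M = refl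
  det-transpose (suc n) M = trans
    (Σ-cong (suc n) (λ j → cong (λ u → sign (toℕ j) (M j zero *R u)) (det-transpose n (firstColumnMinor M j))))
    (sym (det-firstColumnExpansion n M))

  conj-sign : ∀ m (x : R c) → conj (sign m x) ≡ sign m (conj x)
  conj-sign m x = begin
    conj (sign m x)         ≡⟨ cong conj (sign≡sgn* m x) ⟩
    conj (sgn m *R x)       ≡⟨ conj-* _ _ ⟩
    conj (sgn m) *R conj x  ≡⟨ cong (_*R conj x) (conj-sgn m) ⟩
    sgn m *R conj x         ≡⟨ sign≡sgn* m _ ⟨
    sign m (conj x)         ∎
    where open ≡-Reasoning

  conj-det : ∀ n (M : Matrix c n n) → conj (det n M) ≡ det n (conjugate M)
  conj-det zero M = conj-1R
  conj-det (suc n) M = trans (conj-Σ (suc n) (λ j → sign (toℕ j) (M zero j *R det n (firstRowMinor M j))))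
    (Σ-cong (suc n) (λ j → trans (conj-sign (toℕ j) _)
      (cong (sign (toℕ j)) (trans (conj-* _ _) (cong (conj (M zero j) *R_) (conj-det n (firstRowMinor M j)))))))

  det-ᴴ : ∀ n (M : Matrix c n n) → det n (M ᴴ) ≡ conj (det n M)
  det-ᴴ n M = trans (sym (conj-det n (M ᵀ))) (cong conj (det-transpose n M))

  -- D := F - F(δ) · det is multilinear and alternating and vanishes at δ; by the reduction
  -- to increasing row selections of δ (only δ itself) and multilinearity, it vanishes at M = M · δ.
  det-unique : ∀ n (F : Matrix c n n → R c) → Extensional F → Multilinear F → Alternating F →
    ∀ M → F M ≡ F δ *R det n M
  det-unique n F F-ext F-lin F-alt M = x-y≡0⇒x≡y _ _ (trans (D-ext (λ i j → sym (Σ-δʳ n j (M i)))) D[M·δ]≡0)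
    where
    D : Matrix c n n → R c
    D X = F X -R F δ *R det n X
    D-ext : Extensional D
    D-ext X≋Y = cong₂ (λ u v → u -R F δ *R v) (F-ext X≋Y) (det-extensional n X≋Y)
    D-lin : Multilinear D
    D-lin i X Y Z a row X≡Y X≡Z = trans
      (cong₂ (λ u v → u -R F δ *R v) (F-lin i X Y Z a row X≡Y X≡Z) (det-multilinear n i X Y Z a row X≡Y X≡Z))
      (solve 6 (λ a fy fz f1 dy dz → (a :* fy :+ fz) :- f1 :* (a :* dy :+ dz) := a :* (fy :- f1 :* dy) :+ (fz :- f1 :* dz))
             refl a (F Y) (F Z) (F δ) (det n Y) (det n Z))
    D-alt : Alternating D
    D-alt X i j i≢j Xi≡Xj = trans
      (cong₂ (λ u v → u -R F δ *R v) (F-alt X i j i≢j Xi≡Xj) (det-alternating n X i j i≢j Xi≡Xj))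
      (solve 1 (λ f → con (+ 0) :- f :* con (+ 0) := con (+ 0)) refl (F δ))
    D[δ]≡0 : D δ ≡ 0R
    D[δ]≡0 = trans (cong (λ v → F δ -R F δ *R v) (det-δ n)) (solve 1 (λ f → f :- f :* con (+ 1) := con (+ 0)) refl (F δ))
    D[δ∘f]≡0 : ∀ (f : Fin n → Fin n) → D (δ ∘ f) ≡ 0R
    D[δ∘f]≡0 = ∈-increasing⇒∈ ≡0R-isIdeal n D-ext D-lin D-alt δ
      (λ s s↑ → trans (D-ext (λ i j → cong (λ t → δ t j) (increasing⇒≗id n s s↑ i))) D[δ]≡0)
    D[M·δ]≡0 : D (M · δ) ≡ 0R
    D[M·δ]≡0 = multilinear-∈ ≡0R-isIdeal n D-ext D-lin δ D[δ∘f]≡0 M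

  det-· : ∀ n (M N : Matrix c n n) → det n (M · N) ≡ det n M *R det n N
  det-· n M N = trans (det-unique n F F-ext F-lin F-alt M) (trans (cong (_*R det n M) F[δ]≡det[N]) (*R-comm _ _))
    where
    F : Matrix c n n → R c
    F X = det n (X · N)
    F-ext : Extensional F
    F-ext X≋Y = det-extensional n (·-cong X≋Y (λ _ _ → refl))
    F-lin : Multilinear F
    F-lin i X Y Z a row X≡Y X≡Z = det-multilinear n i _ _ _ a
      (λ s → Σ-linear n a _ _ _ (λ r → trans (cong (_*R N r s) (row r))
        (solve 4 (λ a y z m → (a :* y :+ z) :* m := a :* (y :* m) :+ z :* m) refl a (Y i r) (Z i r) (N r s))))
      (λ r r≢i s → Σ-cong n (λ t → cong (_*R N t s) (X≡Y r r≢i t)))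
      (λ r r≢i s → Σ-cong n (λ t → cong (_*R N t s) (X≡Z r r≢i t)))
    F-alt : Alternating F
    F-alt X i j i≢j Xi≡Xj = det-alternating n _ i j i≢j (λ s → Σ-cong n (λ t → cong (_*R N t s) (Xi≡Xj t)))
    F[δ]≡det[N] : F δ ≡ det n N
    F[δ]≡det[N] = det-extensional n (·-identityˡ N)

data SplitView (k m : ℕ) : Fin (k ℕ.+ m) → Set where
  left : ∀ i → SplitView k m (i ↑ˡ m)
  right : ∀ j → SplitView k m (k ↑ʳ j)

splitView : ∀ k m (x : Fin (k ℕ.+ m)) → SplitView k m x
splitView zero m x = right x
splitView (suc k) m zero = left zero
splitView (suc k) m (suc x) with splitView k m x
... | left i = left (suc i)
... | right j = right j

module _ {c : Case} where
  open R-Solver c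

  det-scalar : ∀ k (M : Matrix c k k) (a : ℕ) → (∀ i j → M i j ≡ ι (+ a) *R δ i j) → det k M ≡ ι (+ (a ^ k))
  det-scalar zero M a M≡aδ = refl
  det-scalar (suc k) M a M≡aδ = begin
    M zero zero *R det k (firstRowMinor M zero) +R Σ[ k ] (λ j → sign (toℕ (suc j)) (M zero (suc j) *R det k (firstRowMinor M (suc j))))
      ≡⟨ cong₂ _+R_ (cong₂ _*R_ (trans (M≡aδ zero zero) (*R-identityʳ _)) (det-scalar k (firstRowMinor M zero) a (λ i j → M≡aδ (suc i) (suc j))))
                    (Σ-zero k (λ j → trans (cong (λ u → sign (toℕ (suc j)) (u *R det k (firstRowMinor M (suc j)))) (trans (M≡aδ zero (suc j)) (*R-zeroʳ _)))
                                           (sign-0R* (toℕ (suc j)) _))) ⟩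
    ι (+ a) *R ι (+ (a ^ k)) +R 0R    ≡⟨ +R-identityʳ _ ⟩
    ι (+ a) *R ι (+ (a ^ k))          ≡⟨ ι-* (+ a) (+ (a ^ k)) ⟨
    ι (+ a ℤ.* + (a ^ k))             ≡⟨ cong ι (ℤₚ.pos-* a (a ^ k)) ⟨
    ι (+ (a ^ suc k))                 ∎
    where open ≡-Reasoning

  det-blockIdentity : ∀ k m (M : Matrix c (k ℕ.+ m) (k ℕ.+ m)) →
    (∀ i j → M (i ↑ˡ m) (j ↑ˡ m) ≡ δ i j) → (∀ i j → M (i ↑ˡ m) (k ↑ʳ j) ≡ 0R) →
    det (k ℕ.+ m) M ≡ det m (λ i j → M (k ↑ʳ i) (k ↑ʳ j))
  det-blockIdentity zero m M _ _ = refl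
  det-blockIdentity (suc k) m M top-left top-right = trans
    (cong₂ _+R_
      (trans (cong (_*R det (k ℕ.+ m) (firstRowMinor M zero)) (top-left zero zero))
        (trans (*R-identityˡ _)
          (det-blockIdentity k m (firstRowMinor M zero) (λ i j → top-left (suc i) (suc j)) (λ i j → top-right (suc i) j))))
      (Σ-zero (k ℕ.+ m) (λ j → trans (cong (λ u → sign (toℕ (suc j)) (u *R det (k ℕ.+ m) (firstRowMinor M (suc j))))
                                           (row0 j (splitView k m j)))
                                     (sign-0R* (toℕ (suc j)) _))))
    (+R-identityʳ _)
    where
    row0 : ∀ j → SplitView k m j → M zero (suc j) ≡ 0R
    row0 .(i ↑ˡ m) (left i) = top-left zero (suc i)
    row0 .(k ↑ʳ j) (right j) = top-right zero j

  withTopLeft : ∀ k m → Matrix c (k ℕ.+ m) (k ℕ.+ m) → Matrix c k k → Matrix c (k ℕ.+ m) (k ℕ.+ m)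
  withTopLeft k m M X r s = [ (λ i → [ X i , (λ _ → M r s) ]′ (splitAt k s)) , (λ _ → M r s) ]′ (splitAt k r)

  module _ (k m : ℕ) (M : Matrix c (k ℕ.+ m) (k ℕ.+ m)) where

    withTopLeft-TL : ∀ X i j → withTopLeft k m M X (i ↑ˡ m) (j ↑ˡ m) ≡ X i j
    withTopLeft-TL X i j rewrite Finₚ.splitAt-↑ˡ k i m | Finₚ.splitAt-↑ˡ k j m = refl

    withTopLeft-TR : ∀ X i j → withTopLeft k m M X (i ↑ˡ m) (k ↑ʳ j) ≡ M (i ↑ˡ m) (k ↑ʳ j)
    withTopLeft-TR X i j rewrite Finₚ.splitAt-↑ˡ k i m | Finₚ.splitAt-↑ʳ k m j = refl

    withTopLeft-bottom : ∀ X i s → withTopLeft k m M X (k ↑ʳ i) s ≡ M (k ↑ʳ i) s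
    withTopLeft-bottom X i s rewrite Finₚ.splitAt-↑ʳ k m i = refl

    withTopLeft-self : M ≋ withTopLeft k m M (λ i j → M (i ↑ˡ m) (j ↑ˡ m))
    withTopLeft-self r s = go (splitView k m r) (splitView k m s)
      where
      go : ∀ {r s} → SplitView k m r → SplitView k m s → M r s ≡ withTopLeft k m M (λ i j → M (i ↑ˡ m) (j ↑ˡ m)) r s
      go (left i) (left j) = sym (withTopLeft-TL _ i j)
      go (left i) (right j) = sym (withTopLeft-TR _ i j)
      go {s = s} (right i) _ = sym (withTopLeft-bottom _ i s)

    withTopLeft-pointwise : ∀ {X Y} r s →
      (∀ i j → r ≡ i ↑ˡ m → s ≡ j ↑ˡ m → X i j ≡ Y i j) → withTopLeft k m M X r s ≡ withTopLeft k m M Y r s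
    withTopLeft-pointwise {X} {Y} r s X≡Y = go (splitView k m r) (splitView k m s) X≡Y
      where
      go : ∀ {r s} → SplitView k m r → SplitView k m s →
        (∀ i j → r ≡ i ↑ˡ m → s ≡ j ↑ˡ m → X i j ≡ Y i j) → withTopLeft k m M X r s ≡ withTopLeft k m M Y r s
      go (left i) (left j) X≡Y = trans (withTopLeft-TL X i j) (trans (X≡Y i j refl refl) (sym (withTopLeft-TL Y i j)))
      go (left i) (right j) _ = trans (withTopLeft-TR X i j) (sym (withTopLeft-TR Y i j))
      go {s = s} (right i) _ _ = trans (withTopLeft-bottom X i s) (sym (withTopLeft-bottom Y i s))

    module _ (top-right≡0 : ∀ i j → M (i ↑ˡ m) (k ↑ʳ j) ≡ 0R) where

      det∘withTopLeft-extensional : Extensional (det (k ℕ.+ m) ∘ withTopLeft k m M)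
      det∘withTopLeft-extensional X≋Y =
        det-extensional (k ℕ.+ m) (λ r s → withTopLeft-pointwise r s (λ i j _ _ → X≋Y i j))

      det∘withTopLeft-multilinear : Multilinear (det (k ℕ.+ m) ∘ withTopLeft k m M)
      det∘withTopLeft-multilinear i X Y Z a row X≡Y X≡Z = det-multilinear (k ℕ.+ m) (i ↑ˡ m)
        (withTopLeft k m M X) (withTopLeft k m M Y) (withTopLeft k m M Z) a (λ s → row' (splitView k m s)) (off-i X≡Y) (off-i X≡Z)
        where
        row' : ∀ {s} → SplitView k m s →
          withTopLeft k m M X (i ↑ˡ m) s ≡ a *R withTopLeft k m M Y (i ↑ˡ m) s +R withTopLeft k m M Z (i ↑ˡ m) s
        row' (left j) = trans (withTopLeft-TL X i j)
          (trans (row j) (sym (cong₂ (λ u v → a *R u +R v) (withTopLeft-TL Y i j) (withTopLeft-TL Z i j))))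
        row' (right j) = trans (withTopLeft-TR X i j) (trans (top-right≡0 i j) (sym (begin
          a *R withTopLeft k m M Y (i ↑ˡ m) (k ↑ʳ j) +R withTopLeft k m M Z (i ↑ˡ m) (k ↑ʳ j)
            ≡⟨ cong₂ (λ u v → a *R u +R v) (trans (withTopLeft-TR Y i j) (top-right≡0 i j))
                                            (trans (withTopLeft-TR Z i j) (top-right≡0 i j)) ⟩
          a *R 0R +R 0R ≡⟨ solve 1 (λ a → a :* con (+ 0) :+ con (+ 0) := con (+ 0)) refl a ⟩
          0R ∎)))
          where open ≡-Reasoning
        off-i : ∀ {W} → (∀ r → r ≢ i → ∀ s → X r s ≡ W r s) →
          ∀ r → r ≢ i ↑ˡ m → ∀ s → withTopLeft k m M X r s ≡ withTopLeft k m M W r s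
        off-i X≡W r r≢i s = withTopLeft-pointwise r s
          (λ i' j r≡i' _ → X≡W i' (λ i'≡i → r≢i (trans r≡i' (cong (_↑ˡ m) i'≡i))) j)

      det∘withTopLeft-alternating : Alternating (det (k ℕ.+ m) ∘ withTopLeft k m M)
      det∘withTopLeft-alternating X i j i≢j Xi≡Xj = det-alternating (k ℕ.+ m) (withTopLeft k m M X) (i ↑ˡ m) (j ↑ˡ m)
        (i≢j ∘ Finₚ.↑ˡ-injective m i j) (λ s → rows-equal (splitView k m s))
        where
        rows-equal : ∀ {s} → SplitView k m s → withTopLeft k m M X (i ↑ˡ m) s ≡ withTopLeft k m M X (j ↑ˡ m) s
        rows-equal (left l) = trans (withTopLeft-TL X i l) (trans (Xi≡Xj l) (sym (withTopLeft-TL X j l)))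
        rows-equal (right l) = trans (withTopLeft-TR X i l)
          (trans (top-right≡0 i l) (sym (trans (withTopLeft-TR X j l) (top-right≡0 j l))))

  -- As a function of the top-left block, det M is multilinear and alternating, so det-unique
  -- splits off det TL and leaves a matrix handled by det-blockIdentity.
  det-blockLowerTriangular : ∀ k m (M : Matrix c (k ℕ.+ m) (k ℕ.+ m)) → (∀ i j → M (i ↑ˡ m) (k ↑ʳ j) ≡ 0R) →
    det (k ℕ.+ m) M ≡ det k (λ i j → M (i ↑ˡ m) (j ↑ˡ m)) *R det m (λ i j → M (k ↑ʳ i) (k ↑ʳ j))
  det-blockLowerTriangular k m M top-right≡0 = begin
    det (k ℕ.+ m) M                 ≡⟨ det-extensional (k ℕ.+ m) (withTopLeft-self k m M) ⟩
    det (k ℕ.+ m) (withTopLeft k m M TL) ≡⟨ det-unique k (det (k ℕ.+ m) ∘ withTopLeft k m M)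
                                          (det∘withTopLeft-extensional k m M top-right≡0)
                                          (det∘withTopLeft-multilinear k m M top-right≡0)
                                          (det∘withTopLeft-alternating k m M top-right≡0) TL ⟩
    det (k ℕ.+ m) (withTopLeft k m M δ) *R det k TL
      ≡⟨ cong (_*R det k TL) (det-blockIdentity k m (withTopLeft k m M δ) (withTopLeft-TL k m M δ)
                               (λ i j → trans (withTopLeft-TR k m M δ i j) (top-right≡0 i j))) ⟩
    det m (λ i j → withTopLeft k m M δ (k ↑ʳ i) (k ↑ʳ j)) *R det k TL
      ≡⟨ cong (_*R det k TL) (det-extensional m (λ i j → withTopLeft-bottom k m M δ i (k ↑ʳ j))) ⟩
    det m BR *R det k TL            ≡⟨ *R-comm _ _ ⟩
    det k TL *R det m BR            ∎
    where
    open ≡-Reasoning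
    TL : Matrix c k k
    TL i j = M (i ↑ˡ m) (j ↑ˡ m)
    BR : Matrix c m m
    BR i j = M (k ↑ʳ i) (k ↑ʳ j)

  det-blockUpperTriangular : ∀ k m (M : Matrix c (k ℕ.+ m) (k ℕ.+ m)) → (∀ i j → M (k ↑ʳ i) (j ↑ˡ m) ≡ 0R) →
    det (k ℕ.+ m) M ≡ det k (λ i j → M (i ↑ˡ m) (j ↑ˡ m)) *R det m (λ i j → M (k ↑ʳ i) (k ↑ʳ j))
  det-blockUpperTriangular k m M bottom-left = begin
    det (k ℕ.+ m) M         ≡⟨ det-transpose (k ℕ.+ m) M ⟨
    det (k ℕ.+ m) (M ᵀ)     ≡⟨ det-blockLowerTriangular k m (M ᵀ) (λ i j → bottom-left j i) ⟩
    det k _ *R det m _      ≡⟨ cong₂ _*R_ (det-transpose k _) (det-transpose m _) ⟩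
    det k (λ i j → M (i ↑ˡ m) (j ↑ˡ m)) *R det m (λ i j → M (k ↑ʳ i) (k ↑ʳ j)) ∎
    where open ≡-Reasoning

-- Unimodular row reduction

module _ {c : Case} where
  open R-Solver c

  record Unimodular (n : ℕ) : Set where
    field
      U U⁻¹ : Matrix c n n
      U·U⁻¹ : U · U⁻¹ ≋ δ
      U⁻¹·U : U⁻¹ · U ≋ δ

  open Unimodular

  δ-unimodular : ∀ {n} → Unimodular n
  δ-unimodular = record { U = δ ; U⁻¹ = δ ; U·U⁻¹ = ·-identityˡ δ ; U⁻¹·U = ·-identityˡ δ }

  ·-inverse : ∀ {n} (A B C D : Matrix c n n) → B · C ≋ δ → A · D ≋ δ → (A · B) · (C · D) ≋ δ
  ·-inverse A B C D B·C≋δ A·D≋δ i j = begin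
    ((A · B) · (C · D)) i j  ≡⟨ ·-assoc A B (C · D) i j ⟩
    (A · (B · (C · D))) i j  ≡⟨ ·-cong {M = A} (λ _ _ → refl) B·[C·D]≋D i j ⟩
    (A · D) i j              ≡⟨ A·D≋δ i j ⟩
    δ i j                    ∎
    where
    open ≡-Reasoning
    B·[C·D]≋D : B · (C · D) ≋ D
    B·[C·D]≋D i j = trans (sym (·-assoc B C D i j)) (trans (·-cong {N = D} B·C≋δ (λ _ _ → refl) i j) (·-identityˡ D i j))

  _·U_ : ∀ {n} → Unimodular n → Unimodular n → Unimodular n
  P ·U Q = record
    { U = U P · U Q ; U⁻¹ = U⁻¹ Q · U⁻¹ P
    ; U·U⁻¹ = ·-inverse (U P) (U Q) (U⁻¹ Q) (U⁻¹ P) (U·U⁻¹ Q) (U·U⁻¹ P)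
    ; U⁻¹·U = ·-inverse (U⁻¹ Q) (U⁻¹ P) (U P) (U Q) (U⁻¹·U P) (U⁻¹·U Q) }

  1⊕_ : ∀ {n} → Matrix c n n → Matrix c (suc n) (suc n)
  (1⊕ X) zero zero = 1R
  (1⊕ X) zero (suc j) = 0R
  (1⊕ X) (suc i) zero = 0R
  (1⊕ X) (suc i) (suc j) = X i j

  1⊕-· : ∀ {n} (X Y : Matrix c n n) → (1⊕ X) · (1⊕ Y) ≋ 1⊕ (X · Y)
  1⊕-· {n} X Y zero zero = trans (cong (1R *R 1R +R_) (Σ-zero n (λ t → *R-zeroˡ 0R)))
    (solve 0 (con (+ 1) :* con (+ 1) :+ con (+ 0) := con (+ 1)) refl)
  1⊕-· {n} X Y zero (suc j) = trans (cong (1R *R 0R +R_) (Σ-zero n (λ t → *R-zeroˡ _)))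
    (solve 0 (con (+ 1) :* con (+ 0) :+ con (+ 0) := con (+ 0)) refl)
  1⊕-· {n} X Y (suc i) zero = trans (cong (0R *R 1R +R_) (Σ-zero n (λ t → *R-zeroʳ _)))
    (solve 0 (con (+ 0) :* con (+ 1) :+ con (+ 0) := con (+ 0)) refl)
  1⊕-· {n} X Y (suc i) (suc j) = trans (cong (_+R (X · Y) i j) (*R-zeroˡ 0R)) (+R-identityˡ _)

  1⊕-cong : ∀ {n} {X Y : Matrix c n n} → X ≋ Y → 1⊕ X ≋ 1⊕ Y
  1⊕-cong X≋Y zero zero = refl
  1⊕-cong X≋Y zero (suc j) = refl
  1⊕-cong X≋Y (suc i) zero = refl
  1⊕-cong X≋Y (suc i) (suc j) = X≋Y i j

  1⊕δ : ∀ {n} → 1⊕ δ {n = n} ≋ δ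
  1⊕δ zero zero = refl
  1⊕δ zero (suc j) = refl
  1⊕δ (suc i) zero = refl
  1⊕δ (suc i) (suc j) = refl

  1⊕-unimodular : ∀ {n} → Unimodular n → Unimodular (suc n)
  1⊕-unimodular P = record
    { U = 1⊕ U P ; U⁻¹ = 1⊕ U⁻¹ P
    ; U·U⁻¹ = λ i j → trans (1⊕-· (U P) (U⁻¹ P) i j) (trans (1⊕-cong (U·U⁻¹ P) i j) (1⊕δ i j))
    ; U⁻¹·U = λ i j → trans (1⊕-· (U⁻¹ P) (U P) i j) (trans (1⊕-cong (U⁻¹·U P) i j) (1⊕δ i j)) }

  2×2⊕δ : ∀ {n} → R c → R c → R c → R c → Matrix c (2 ℕ.+ n) (2 ℕ.+ n)
  2×2⊕δ x y z w zero zero = x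
  2×2⊕δ x y z w zero (suc zero) = y
  2×2⊕δ x y z w zero (suc (suc j)) = 0R
  2×2⊕δ x y z w (suc zero) zero = z
  2×2⊕δ x y z w (suc zero) (suc zero) = w
  2×2⊕δ x y z w (suc zero) (suc (suc j)) = 0R
  2×2⊕δ x y z w (suc (suc i)) zero = 0R
  2×2⊕δ x y z w (suc (suc i)) (suc zero) = 0R
  2×2⊕δ x y z w (suc (suc i)) (suc (suc j)) = δ i j

  2×2⊕δ-· : ∀ {n} x y z w x' y' z' w' →
    2×2⊕δ {n = n} x y z w · 2×2⊕δ x' y' z' w'
      ≋ 2×2⊕δ (x *R x' +R y *R z') (x *R y' +R y *R w') (z *R x' +R w *R z') (z *R y' +R w *R w')
  2×2⊕δ-· {n} x y z w x' y' z' w' = entry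
    where
    2×2-block : ∀ a b a' b' → a *R a' +R (b *R b' +R Σ[ n ] (λ t → 0R *R 0R)) ≡ a *R a' +R b *R b'
    2×2-block a b a' b' = trans (cong (λ t → a *R a' +R (b *R b' +R t)) (Σ-zero n (λ t → *R-zeroˡ 0R)))
                          (cong (a *R a' +R_) (+R-identityʳ _))
    to-δ-block : ∀ a b {f : Fin n → R c} → a *R 0R +R (b *R 0R +R Σ[ n ] (λ t → 0R *R f t)) ≡ 0R
    to-δ-block a b = trans (cong (λ t → a *R 0R +R (b *R 0R +R t)) (Σ-zero n (λ t → *R-zeroˡ _)))
      (solve 2 (λ a b → a :* con (+ 0) :+ (b :* con (+ 0) :+ con (+ 0)) := con (+ 0)) refl a b)
    from-δ-block : ∀ a b {f : Fin n → R c} → 0R *R a +R (0R *R b +R Σ[ n ] (λ t → f t *R 0R)) ≡ 0R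
    from-δ-block a b = trans (cong (λ t → 0R *R a +R (0R *R b +R t)) (Σ-zero n (λ t → *R-zeroʳ _)))
      (solve 2 (λ a b → con (+ 0) :* a :+ (con (+ 0) :* b :+ con (+ 0)) := con (+ 0)) refl a b)
    entry : _ ≋ _
    entry zero zero = 2×2-block x y x' z'
    entry zero (suc zero) = 2×2-block x y y' w'
    entry zero (suc (suc j)) = to-δ-block x y
    entry (suc zero) zero = 2×2-block z w x' z'
    entry (suc zero) (suc zero) = 2×2-block z w y' w'
    entry (suc zero) (suc (suc j)) = to-δ-block z w
    entry (suc (suc i)) zero = from-δ-block x' z'
    entry (suc (suc i)) (suc zero) = from-δ-block y' w'
    entry (suc (suc i)) (suc (suc j)) = trans (cong₂ (λ u t → u +R (u +R t)) (*R-zeroˡ 0R) (Σ-δˡ n i (λ t → δ t j)))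
      (trans (+R-identityˡ _) (+R-identityˡ _))

  2×2⊕δ≋δ : ∀ {n} {x y z w : R c} → x ≡ 1R → y ≡ 0R → z ≡ 0R → w ≡ 1R → 2×2⊕δ {n = n} x y z w ≋ δ
  2×2⊕δ≋δ x≡1 y≡0 z≡0 w≡1 zero zero = x≡1
  2×2⊕δ≋δ x≡1 y≡0 z≡0 w≡1 zero (suc zero) = y≡0
  2×2⊕δ≋δ x≡1 y≡0 z≡0 w≡1 zero (suc (suc j)) = refl
  2×2⊕δ≋δ x≡1 y≡0 z≡0 w≡1 (suc zero) zero = z≡0
  2×2⊕δ≋δ x≡1 y≡0 z≡0 w≡1 (suc zero) (suc zero) = w≡1
  2×2⊕δ≋δ x≡1 y≡0 z≡0 w≡1 (suc zero) (suc (suc j)) = refl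
  2×2⊕δ≋δ x≡1 y≡0 z≡0 w≡1 (suc (suc i)) zero = refl
  2×2⊕δ≋δ x≡1 y≡0 z≡0 w≡1 (suc (suc i)) (suc zero) = refl
  2×2⊕δ≋δ x≡1 y≡0 z≡0 w≡1 (suc (suc i)) (suc (suc j)) = refl

  infixl 7 _·ᵥ_
  _·ᵥ_ : ∀ {n m} → Matrix c n m → (Fin m → R c) → Fin n → R c
  _·ᵥ_ {m = m} M a i = Σ[ m ] (λ t → M i t *R a t)

  ·ᵥ-assoc : ∀ {n m p} (A : Matrix c n m) (B : Matrix c m p) (a : Fin p → R c) i → (A · B ·ᵥ a) i ≡ (A ·ᵥ (B ·ᵥ a)) i
  ·ᵥ-assoc A B a i = ·-assoc A B (λ t (_ : Fin 1) → a t) i zero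

  δ-·ᵥ : ∀ {n} (w : Fin n → R c) i → (δ ·ᵥ w) i ≡ w i
  δ-·ᵥ {n} w i = Σ-δˡ n i w

  ᴴ-inverse-·ᵥ : ∀ {n} (U U⁻¹ : Matrix c n n) → U⁻¹ · U ≋ δ → ∀ w i → (U ᴴ ·ᵥ (U⁻¹ ᴴ ·ᵥ w)) i ≡ w i
  ᴴ-inverse-·ᵥ U U⁻¹ U⁻¹U≋δ w i = begin
    (U ᴴ ·ᵥ (U⁻¹ ᴴ ·ᵥ w)) i   ≡⟨ ·ᵥ-assoc (U ᴴ) (U⁻¹ ᴴ) w i ⟨
    (U ᴴ · U⁻¹ ᴴ ·ᵥ w) i      ≡⟨ Σ-cong _ (λ t → cong (_*R w t) (trans (sym (ᴴ-· U⁻¹ U i t)) (trans (cong conj (U⁻¹U≋δ t i)) (δᴴ i t)))) ⟩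
    (δ ·ᵥ w) i                ≡⟨ δ-·ᵥ w i ⟩
    w i                       ∎
    where open ≡-Reasoning

  1⊕-·ᵥ-zero : ∀ {n} (X : Matrix c n n) (a : Fin (suc n) → R c) → (1⊕ X ·ᵥ a) zero ≡ a zero
  1⊕-·ᵥ-zero {n} X a = trans (cong (1R *R a zero +R_) (Σ-zero n (λ t → *R-zeroˡ (a (suc t)))))
                             (trans (+R-identityʳ _) (*R-identityˡ _))

  1⊕-·ᵥ-suc : ∀ {n} (X : Matrix c n n) (a : Fin (suc n) → R c) r → (1⊕ X ·ᵥ a) (suc r) ≡ (X ·ᵥ (a ∘ suc)) r
  1⊕-·ᵥ-suc X a r = trans (cong (_+R (X ·ᵥ (a ∘ suc)) r) (*R-zeroˡ _)) (+R-identityˡ _)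

  2×2⊕δ-·ᵥ-lower : ∀ {n} x y z w (v : Fin (2 ℕ.+ n) → R c) r → (2×2⊕δ x y z w ·ᵥ v) (suc (suc r)) ≡ v (suc (suc r))
  2×2⊕δ-·ᵥ-lower {n} x y z w v r = begin
    0R *R v zero +R (0R *R v (suc zero) +R Σ[ n ] (λ t → δ r t *R v (suc (suc t))))
      ≡⟨ cong₂ (λ u u' → u +R (u' +R Σ[ n ] (λ t → δ r t *R v (suc (suc t))))) (*R-zeroˡ _) (*R-zeroˡ _) ⟩
    0R +R (0R +R Σ[ n ] (λ t → δ r t *R v (suc (suc t))))
      ≡⟨ trans (+R-identityˡ _) (+R-identityˡ _) ⟩
    Σ[ n ] (λ t → δ r t *R v (suc (suc t)))
      ≡⟨ Σ-δˡ n r (λ t → v (suc (suc t))) ⟩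
    v (suc (suc r)) ∎
    where open ≡-Reasoning

  -- With s a₀ + t b₀ = 1, the matrix ((s, t), (-b₀, a₀)) is invertible and kills (a₀ d, b₀ d).
  bezoutUnimodular : ∀ {n} {a b : R c} → Bezout a b → Unimodular (2 ℕ.+ n)
  bezoutUnimodular B = record
    { U = 2×2⊕δ s t (-R b₀) a₀ ; U⁻¹ = 2×2⊕δ a₀ (-R t) b₀ s
    ; U·U⁻¹ = λ i j → trans (2×2⊕δ-· s t (-R b₀) a₀ a₀ (-R t) b₀ s i j) (2×2⊕δ≋δ
        (trans (solve 4 (λ s t a b → s :* a :+ t :* b := s :* a :+ t :* b) refl s t a₀ b₀) sa₀+tb₀≡1)
        (solve 2 (λ s t → s :* (:- t) :+ t :* s := con (+ 0)) refl s t)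
        (solve 2 (λ a b → (:- b) :* a :+ a :* b := con (+ 0)) refl a₀ b₀)
        (trans (solve 4 (λ s t a b → (:- b) :* (:- t) :+ a :* s := s :* a :+ t :* b) refl s t a₀ b₀) sa₀+tb₀≡1) i j)
    ; U⁻¹·U = λ i j → trans (2×2⊕δ-· a₀ (-R t) b₀ s s t (-R b₀) a₀ i j) (2×2⊕δ≋δ
        (trans (solve 4 (λ s t a b → a :* s :+ (:- t) :* (:- b) := s :* a :+ t :* b) refl s t a₀ b₀) sa₀+tb₀≡1)
        (solve 2 (λ t a → a :* t :+ (:- t) :* a := con (+ 0)) refl t a₀)
        (solve 2 (λ s b → b :* s :+ s :* (:- b) := con (+ 0)) refl s b₀)
        (trans (solve 4 (λ s t a b → b :* t :+ s :* a := s :* a :+ t :* b) refl s t a₀ b₀) sa₀+tb₀≡1) i j) }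
    where open Bezout B

  bezoutUnimodular-clears : ∀ {n} {a b : R c} (B : Bezout a b) (v : Fin (2 ℕ.+ n) → R c) →
    v zero ≡ a → v (suc zero) ≡ b → (U (bezoutUnimodular {n} B) ·ᵥ v) (suc zero) ≡ 0R
  bezoutUnimodular-clears {n} B v v₀≡a v₁≡b = begin
    (-R b₀) *R v zero +R (a₀ *R v (suc zero) +R Σ[ n ] (λ t → 0R *R v (suc (suc t))))
      ≡⟨ cong₂ (λ u u' → (-R b₀) *R u +R (a₀ *R u' +R Σ[ n ] (λ t → 0R *R v (suc (suc t)))))
               (trans v₀≡a a≡a₀d) (trans v₁≡b b≡b₀d) ⟩
    (-R b₀) *R (a₀ *R d) +R (a₀ *R (b₀ *R d) +R Σ[ n ] (λ t → 0R *R v (suc (suc t))))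
      ≡⟨ cong (λ t → (-R b₀) *R (a₀ *R d) +R (a₀ *R (b₀ *R d) +R t)) (Σ-zero n (λ t → *R-zeroˡ _)) ⟩
    (-R b₀) *R (a₀ *R d) +R (a₀ *R (b₀ *R d) +R 0R)
      ≡⟨ solve 3 (λ a b d → (:- b) :* (a :* d) :+ (a :* (b :* d) :+ con (+ 0)) := con (+ 0)) refl a₀ b₀ d ⟩
    0R ∎
    where
    open ≡-Reasoning
    open Bezout B

  -- Clear all but the first two entries by recursion, then those two by Bezout.
  clearColumn : ∀ n (a : Fin (suc n) → R c) → Σ (Unimodular (suc n)) (λ P → ∀ r → (U P ·ᵥ a) (suc r) ≡ 0R)
  clearColumn zero a = δ-unimodular , λ ()
  clearColumn (suc n) a = T ·U 1⊕-unimodular P' , cleared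
    where
    P' = proj₁ (clearColumn n (a ∘ suc))
    b = 1⊕ U P' ·ᵥ a
    B = bezout (a zero) (b (suc zero))
    open Bezout B using (s; t; a₀; b₀)
    T = bezoutUnimodular B
    T·b-suc : ∀ r → (U T ·ᵥ b) (suc r) ≡ 0R
    T·b-suc zero = bezoutUnimodular-clears B b (1⊕-·ᵥ-zero (U P') a) refl
    T·b-suc (suc r) = trans (2×2⊕δ-·ᵥ-lower s t (-R b₀) a₀ b r)
                            (trans (1⊕-·ᵥ-suc (U P') a (suc r)) (proj₂ (clearColumn n (a ∘ suc)) r))
    cleared : ∀ r → (U T · 1⊕ U P' ·ᵥ a) (suc r) ≡ 0R
    cleared r = trans (·ᵥ-assoc (U T) (1⊕ U P') a (suc r)) (T·b-suc r)

  eliminate : ∀ k m (A : Matrix c (k ℕ.+ m) k) → Σ (Unimodular (k ℕ.+ m)) (λ P → ∀ l j → (U P · A) (k ↑ʳ l) j ≡ 0R)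
  eliminate zero m A = δ-unimodular , λ l ()
  eliminate (suc k) m A = 1⊕-unimodular P' ·U P₀ , cleared
    where
    P₀ = proj₁ (clearColumn (k ℕ.+ m) (λ t → A t zero))
    U₀A = U P₀ · A
    A' : Matrix c (k ℕ.+ m) k
    A' r j = U₀A (suc r) (suc j)
    P' = proj₁ (eliminate k m A')
    cleared' : ∀ l j → (1⊕ U P' · U₀A) (suc (k ↑ʳ l)) j ≡ 0R
    cleared' l zero = trans (cong₂ _+R_ (*R-zeroˡ _) (Σ-zero (k ℕ.+ m)
        (λ t → trans (cong (U P' (k ↑ʳ l) t *R_) (proj₂ (clearColumn (k ℕ.+ m) (λ t → A t zero)) t)) (*R-zeroʳ _))))
      (+R-identityˡ _)
    cleared' l (suc j) = trans (cong (_+R (U P' · A') (k ↑ʳ l) j) (*R-zeroˡ _))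
                               (trans (+R-identityˡ _) (proj₂ (eliminate k m A') l j))
    cleared : ∀ l j → (1⊕ U P' · U P₀ · A) (suc (k ↑ʳ l)) j ≡ 0R
    cleared l j = trans (·-assoc (1⊕ U P') (U P₀) A (suc (k ↑ʳ l)) j) (cleared' l j)

  unimodular⇒absSq[det]≡1 : ∀ {n} (P : Unimodular n) → absSq (det n (U P)) ≡ 1R
  unimodular⇒absSq[det]≡1 {n} P = x*y≡1⇒absSq[x]≡1 (det n (U P)) (det n (U⁻¹ P))
    (trans (sym (det-· n (U P) (U⁻¹ P))) (trans (det-extensional n (U·U⁻¹ P)) (det-δ n)))

-- The lattice Λ

module _ {c : Case} where
  open R-Solver c

  -- Replace row r₀ by Σ z r M r: the new determinant is 0 (zero row) and z r₀ · det M (linearity).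
  left-kernel⇒*det≡0 : ∀ k (M : Matrix c k k) (z : Fin k → R c) → (∀ j → Σ[ k ] (λ r → z r *R M r j) ≡ 0R) →
    ∀ r₀ → z r₀ *R det k M ≡ 0R
  left-kernel⇒*det≡0 k M z zM≡0 r₀ = begin
    z r₀ *R det k M
      ≡⟨ cong (z r₀ *R_) (det-extensional k (λ i s → cong (λ f → f s) (setRow-self M r₀ i))) ⟨
    z r₀ *R det k (setRow M r₀ (M r₀))
      ≡⟨ Σ-single k (λ r → z r *R det k (setRow M r₀ (M r))) r₀ repeated-row ⟨
    Σ[ k ] (λ r → z r *R det k (setRow M r₀ (M r)))
      ≡⟨ Σ-cong k (λ r → cong (z r *R_) (det-extensional k (λ i s → cong (λ f → f s) (setRow-setRow M r₀ _ (M r) i)))) ⟨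
    Σ[ k ] (λ r → z r *R det k (setRow X r₀ (M r)))
      ≡⟨ linear-ΣRow (det-extensional k) (det-multilinear k r₀) k X z M X-row ⟨
    det k X
      ≡⟨ linear-zeroRow (det-multilinear k r₀) X (λ s → trans (X-row s) (zM≡0 s)) ⟩
    0R ∎
    where
    open ≡-Reasoning
    X = setRow M r₀ (λ s → Σ[ k ] (λ r → z r *R M r s))
    X-row : ∀ s → X r₀ s ≡ Σ[ k ] (λ r → z r *R M r s)
    X-row s = cong (λ f → f s) (setRow-updates M r₀ _)
    repeated-row : ∀ r → r ≢ r₀ → z r *R det k (setRow M r₀ (M r)) ≡ 0R
    repeated-row r r≢r₀ = trans (cong (z r *R_) (det-alternating k _ r r₀ r≢r₀ (λ s →
      trans (cong (λ f → f s) (setRow-minimal M r₀ (M r) r r≢r₀)) (sym (cong (λ f → f s) (setRow-updates M r₀ (M r)))))))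
      (*R-zeroʳ _)

  icube⇒gram≋λδ : ∀ {n k} (A : Matrix c n k) (λ₀ : ℕ) → IsIcube n k A λ₀ →
    ∀ i j → col A i ∙ col A j ≡ ι (+ λ₀) *R δ i j
  icube⇒gram≋λδ A λ₀ (norms , orthogonal) i j with i Finₚ.≟ j
  ... | yes refl = trans (norms i) (sym (trans (cong (ι (+ λ₀) *R_) (δ-diag i)) (*R-identityʳ _)))
  ... | no i≢j = trans (orthogonal i j i≢j) (sym (trans (cong (ι (+ λ₀) *R_) (δ-offdiag i j i≢j)) (*R-zeroʳ _)))

  detDivisor-∣-det[C·A] : ∀ {n k} (A : Matrix c n k) (g : R c) → IsDetDivisor n k A g →
    ∀ (C : Matrix c k n) → g ∣R det k (C · A)
  detDivisor-∣-det[C·A] {n} {k} A g (g∣minors , _) =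
    multilinear-∈ (∣R-isIdeal g) k (det-extensional k) (det-multilinear k) A
      (∈-increasing⇒∈ (∣R-isIdeal g) n (det-extensional k) (det-multilinear k) (det-alternating k) A g∣minors)

  det-∣-minor[W·H] : ∀ {n k} (W : Matrix c n k) (H : Matrix c k k) (A : Matrix c n k) → A ≋ W · H →
    ∀ s → det k H ∣R minor n k A s
  det-∣-minor[W·H] {k = k} W H A A≋WH s =
    det k (W ∘ s) , trans (det-extensional k (λ i j → A≋WH (s i) j)) (det-· k (W ∘ s) H)

  conj-disc : ∀ m {n} (b : Fin m → Vector c n) → conj (disc m b) ≡ disc m b
  conj-disc m {n} b = trans (conj-det m (gram m b)) (trans (det-extensional m gramᴴ) (det-transpose m (gram m b)))
    where
    gramᴴ : conjugate (gram m b) ≋ gram m b ᵀ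
    gramᴴ i j = trans (conj-Σ n _) (Σ-cong n (λ r →
      trans (conj-* _ _) (trans (cong (_*R conj (b j r)) (conj-involutive _)) (*R-comm _ _))))

  -- A family b : Fin m → Vector c n is read as an m × n matrix; lincomb m (C l) b is row l of C · b.
  coordinates : ∀ {n k} (A : Matrix c n k) m (b b' : Fin m → Vector c n) → IsFreeBasisOfΛ n k A m b' →
    (∀ l → InΛ n k A (b l)) → Σ (Matrix c m m) (λ C → b ≋ C · b')
  coordinates A m b b' (_ , spans , _) b∈Λ = (λ l → proj₁ (spans (b l) (b∈Λ l))) , (λ l → proj₂ (spans (b l) (b∈Λ l)))

  gram-change : ∀ m {n} (b b' : Fin m → Vector c n) (C : Matrix c m m) → b ≋ C · b' →
    gram m b ≋ conjugate C · gram m b' · C ᵀ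
  gram-change m b b' C b≋Cb' = ≋-trans (·-cong conj-b≋ bᵀ≋) (≋-trans (·-cong (conj-· C b') (·-transpose C b'))
    (≋-trans (·-assoc (conjugate C) (conjugate b') (b' ᵀ · C ᵀ))
      (≋-trans (·-cong {M = conjugate C} (λ _ _ → refl) (≋-sym (·-assoc (conjugate b') (b' ᵀ) (C ᵀ))))
               (≋-sym (·-assoc (conjugate C) (gram m b') (C ᵀ))))))
    where
    conj-b≋ : conjugate b ≋ conjugate (C · b')
    conj-b≋ l i = cong conj (b≋Cb' l i)
    bᵀ≋ : b ᵀ ≋ (C · b') ᵀ
    bᵀ≋ i l = b≋Cb' l i

  disc-basis-invariant : ∀ {n k} (A : Matrix c n k) m (b b' : Fin m → Vector c n) →
    IsFreeBasisOfΛ n k A m b → IsFreeBasisOfΛ n k A m b' → disc m b ≡ disc m b'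
  disc-basis-invariant A m b b' b-basis@(b∈Λ , _ , b-independent) b'-basis@(b'∈Λ , _ , _) = begin
    det m (gram m b)                                   ≡⟨ det-extensional m (gram-change m b b' C b≋Cb') ⟩
    det m (conjugate C · gram m b' · C ᵀ)              ≡⟨ det-· m _ (C ᵀ) ⟩
    det m (conjugate C · gram m b') *R det m (C ᵀ)     ≡⟨ cong (_*R det m (C ᵀ)) (det-· m (conjugate C) (gram m b')) ⟩
    det m (conjugate C) *R disc m b' *R det m (C ᵀ)    ≡⟨ cong₂ (λ u v → u *R disc m b' *R v) (conj-det m C) (sym (det-transpose m C)) ⟨
    conj (det m C) *R disc m b' *R det m C             ≡⟨ solve 3 (λ x̄ d x → x̄ :* d :* x := (x̄ :* x) :* d) refl (conj (det m C)) (disc m b') (det m C) ⟩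
    absSq (det m C) *R disc m b'                       ≡⟨ cong (_*R disc m b') (x*y≡1⇒absSq[x]≡1 (det m C) (det m D) detC·detD≡1) ⟩
    1R *R disc m b'                                    ≡⟨ *R-identityˡ _ ⟩
    disc m b'                                          ∎
    where
    open ≡-Reasoning
    C = proj₁ (coordinates A m b b' b'-basis b∈Λ)
    b≋Cb' = proj₂ (coordinates A m b b' b'-basis b∈Λ)
    D = proj₁ (coordinates A m b' b b-basis b'∈Λ)
    b'≋Db = proj₂ (coordinates A m b' b b-basis b'∈Λ)
    C·D≋δ : C · D ≋ δ
    C·D≋δ l = b-independent ((C · D) l) (δ l) (λ i → sym (begin
      (δ · b) l i         ≡⟨ ·-identityˡ b l i ⟩
      b l i               ≡⟨ b≋Cb' l i ⟩
      (C · b') l i        ≡⟨ ·-cong {M = C} (λ _ _ → refl) b'≋Db l i ⟩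
      (C · (D · b)) l i   ≡⟨ ·-assoc C D b l i ⟨
      (C · D · b) l i     ∎))
    detC·detD≡1 : det m C *R det m D ≡ 1R
    detC·detD≡1 = trans (sym (det-· m C D)) (trans (det-extensional m C·D≋δ) (det-δ m))

module IcubeLattice {c : Case} (k m : ℕ) (A : Matrix c (k ℕ.+ m) k) (λ₀ : ℕ) (λ₀≢0 : λ₀ ≢ 0)
                    (icube : IsIcube (k ℕ.+ m) k A λ₀) where
  open R-Solver c
  open ≡-Reasoning

  private
    n = k ℕ.+ m

  open Unimodular (proj₁ (eliminate k m A))

  UA-bottom≡0 : ∀ l j → (U · A) (k ↑ʳ l) j ≡ 0R
  UA-bottom≡0 = proj₂ (eliminate k m A)

  H : Matrix c k k
  H i j = (U · A) (i ↑ˡ m) j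

  b₀ : Basis c n m
  b₀ l i = conj (U (k ↑ʳ l) i)

  λᵏ : R c
  λᵏ = ι (+ (λ₀ ^ k))

  λᵏ≢0 : λᵏ ≢ 0R
  λᵏ≢0 = ι-≢0R (λ₀ ^ k) (^-≢0 λ₀ k λ₀≢0)

  A≋U⁻¹·H : A ≋ (λ i r → U⁻¹ i (r ↑ˡ m)) · H
  A≋U⁻¹·H i j = begin
    A i j                     ≡⟨ ·-identityˡ A i j ⟨
    (δ · A) i j               ≡⟨ ·-cong {N = A} (≋-sym U⁻¹·U) (λ _ _ → refl) i j ⟩
    (U⁻¹ · U · A) i j         ≡⟨ ·-assoc U⁻¹ U A i j ⟩
    Σ[ n ] (λ r → U⁻¹ i r *R (U · A) r j)
      ≡⟨ Σ-splitAt k m _ ⟩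
    Σ[ k ] (λ r → U⁻¹ i (r ↑ˡ m) *R H r j) +R Σ[ m ] (λ l → U⁻¹ i (k ↑ʳ l) *R (U · A) (k ↑ʳ l) j)
      ≡⟨ cong (Σ[ k ] (λ r → U⁻¹ i (r ↑ˡ m) *R H r j) +R_) (Σ-zero m (λ l → trans (cong (U⁻¹ i (k ↑ʳ l) *R_) (UA-bottom≡0 l j)) (*R-zeroʳ _))) ⟩
    Σ[ k ] (λ r → U⁻¹ i (r ↑ˡ m) *R H r j) +R 0R
      ≡⟨ +R-identityʳ _ ⟩
    Σ[ k ] (λ r → U⁻¹ i (r ↑ˡ m) *R H r j) ∎

  b₀∈Λ : ∀ l → InΛ n k A (b₀ l)
  b₀∈Λ l j = begin
    Σ[ n ] (λ i → conj (A i j) *R conj (U (k ↑ʳ l) i))  ≡⟨ Σ-cong n (λ i → trans (*R-comm _ _) (sym (conj-* _ _))) ⟩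
    Σ[ n ] (λ i → conj (U (k ↑ʳ l) i *R A i j))         ≡⟨ conj-Σ n _ ⟨
    conj ((U · A) (k ↑ʳ l) j)                           ≡⟨ cong conj (UA-bottom≡0 l j) ⟩
    conj 0R                                             ≡⟨ conj-0R ⟩
    0R                                                  ∎

  -- The square matrix (a₁ | … | a_k | b₀₁ | … | b₀ₘ).
  Ab : Matrix c n n
  Ab = stack (A ᵀ) b₀ ᵀ

  Ab-left : ∀ r j → Ab r (j ↑ˡ m) ≡ A r j
  Ab-left r j = stack-↑ˡ (A ᵀ) b₀ j r

  Ab-right : ∀ r l → Ab r (k ↑ʳ l) ≡ b₀ l r
  Ab-right r l = stack-↑ʳ (A ᵀ) b₀ l r

  det[Q·Ab] : ∀ (Q : Matrix c n n) → (∀ i r → Q (i ↑ˡ m) r ≡ conj (A r i)) →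
    det n (Q · Ab) ≡ λᵏ *R det m (λ l l' → Σ[ n ] (λ r → Q (k ↑ʳ l) r *R b₀ l' r))
  det[Q·Ab] Q Q-top = begin
    det n (Q · Ab)
      ≡⟨ det-blockLowerTriangular k m (Q · Ab) (λ i l → trans (entries i (k ↑ʳ l) (λ r → Ab-right r l)) (b₀∈Λ l i)) ⟩
    det k (λ i j → (Q · Ab) (i ↑ˡ m) (j ↑ˡ m)) *R det m (λ l l' → (Q · Ab) (k ↑ʳ l) (k ↑ʳ l'))
      ≡⟨ cong₂ _*R_ (det-scalar k _ λ₀ (λ i j → trans (entries i (j ↑ˡ m) (λ r → Ab-left r j)) (icube⇒gram≋λδ A λ₀ icube i j)))
                    (det-extensional m (λ l l' → Σ-cong n (λ r → cong (Q (k ↑ʳ l) r *R_) (Ab-right r l')))) ⟩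
    λᵏ *R det m (λ l l' → Σ[ n ] (λ r → Q (k ↑ʳ l) r *R b₀ l' r)) ∎
    where
    entries : ∀ i s {v : Vector c n} → (∀ r → Ab r s ≡ v r) → (Q · Ab) (i ↑ˡ m) s ≡ Σ[ n ] (λ r → conj (A r i) *R v r)
    entries i s Ab≡v = Σ-cong n (λ r → cong₂ _*R_ (Q-top i r) (Ab≡v r))

  absSq[det[Ab]] : absSq (det n Ab) ≡ λᵏ *R disc m b₀
  absSq[det[Ab]] = begin
    conj (det n Ab) *R det n Ab  ≡⟨ cong (_*R det n Ab) (det-ᴴ n Ab) ⟨
    det n (Ab ᴴ) *R det n Ab     ≡⟨ det-· n (Ab ᴴ) Ab ⟨
    det n (Ab ᴴ · Ab)            ≡⟨ det[Q·Ab] (Ab ᴴ) (λ i r → cong conj (Ab-left r i)) ⟩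
    λᵏ *R det m (λ l l' → Σ[ n ] (λ r → conj (Ab r (k ↑ʳ l)) *R b₀ l' r))
      ≡⟨ cong (λᵏ *R_) (det-extensional m (λ l l' → Σ-cong n (λ r → cong (λ x → conj x *R b₀ l' r) (Ab-right r l)))) ⟩
    λᵏ *R disc m b₀              ∎

  det[U]*det[Ab] : det n U *R det n Ab ≡ det k H *R disc m b₀
  det[U]*det[Ab] = begin
    det n U *R det n Ab   ≡⟨ det-· n U Ab ⟨
    det n (U · Ab)        ≡⟨ det-blockUpperTriangular k m (U · Ab)
                               (λ l j → trans (Σ-cong n (λ r → cong (U (k ↑ʳ l) r *R_) (Ab-left r j))) (UA-bottom≡0 l j)) ⟩
    det k (λ i j → (U · Ab) (i ↑ˡ m) (j ↑ˡ m)) *R det m (λ l l' → (U · Ab) (k ↑ʳ l) (k ↑ʳ l'))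
      ≡⟨ cong₂ _*R_ (det-extensional k (λ i j → Σ-cong n (λ r → cong (U (i ↑ˡ m) r *R_) (Ab-left r j))))
                    (det-extensional m (λ l l' → Σ-cong n (λ r → cong₂ _*R_ (sym (conj-involutive _)) (Ab-right r l')))) ⟩
    det k H *R disc m b₀  ∎

  -- Q has rows Aᴴ on top and the conjugated last columns of U⁻¹ below, so that Q · Ab has
  -- determinant λᵏ.
  det[Ab]≢0 : det n Ab ≢ 0R
  det[Ab]≢0 det[Ab]≡0 = λᵏ≢0 (begin
    λᵏ                              ≡⟨ *R-identityʳ λᵏ ⟨
    λᵏ *R 1R                        ≡⟨ cong (λᵏ *R_) (trans (sym (det-δ m)) (det-extensional m bottom≋δ)) ⟩
    λᵏ *R det m (λ l l' → Σ[ n ] (λ r → Q (k ↑ʳ l) r *R b₀ l' r))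
                                    ≡⟨ det[Q·Ab] Q (stack-↑ˡ (A ᴴ) _) ⟨
    det n (Q · Ab)                  ≡⟨ det-· n Q Ab ⟩
    det n Q *R det n Ab             ≡⟨ cong (det n Q *R_) det[Ab]≡0 ⟩
    det n Q *R 0R                   ≡⟨ *R-zeroʳ _ ⟩
    0R                              ∎)
    where
    Q = stack (A ᴴ) (λ l r → conj (U⁻¹ r (k ↑ʳ l)))
    bottom≋δ : δ ≋ (λ l l' → Σ[ n ] (λ r → Q (k ↑ʳ l) r *R b₀ l' r))
    bottom≋δ l l' = sym (begin
      Σ[ n ] (λ r → Q (k ↑ʳ l) r *R b₀ l' r)
        ≡⟨ Σ-cong n (λ r → trans (cong (_*R b₀ l' r) (stack-↑ʳ (A ᴴ) _ l r)) (trans (*R-comm _ _) (sym (conj-* _ _)))) ⟩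
      Σ[ n ] (λ r → conj (U (k ↑ʳ l') r *R U⁻¹ r (k ↑ʳ l)))   ≡⟨ conj-Σ n _ ⟨
      conj ((U · U⁻¹) (k ↑ʳ l') (k ↑ʳ l))                    ≡⟨ cong conj (U·U⁻¹ _ _) ⟩
      conj (δ (k ↑ʳ l') (k ↑ʳ l))                           ≡⟨ δᴴ (k ↑ʳ l) (k ↑ʳ l') ⟩
      δ (k ↑ʳ l) (k ↑ʳ l')                                  ≡⟨ δ-↑ʳ k l l' ⟩
      δ l l'                                                ∎)

  disc[b₀]≢0 : disc m b₀ ≢ 0R
  disc[b₀]≢0 disc≡0 = det[Ab]≢0 (absSq≡0⇒≡0R _ (trans absSq[det[Ab]] (trans (cong (λᵏ *R_) disc≡0) (*R-zeroʳ _))))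

  λᵏ≡absSq[det[H]]*disc : λᵏ ≡ absSq (det k H) *R disc m b₀
  λᵏ≡absSq[det[H]]*disc = *R-cancelʳ _ _ (disc m b₀) disc[b₀]≢0 (begin
    λᵏ *R disc m b₀                             ≡⟨ absSq[det[Ab]] ⟨
    absSq (det n Ab)                            ≡⟨ *R-identityˡ _ ⟨
    1R *R absSq (det n Ab)                      ≡⟨ cong (_*R absSq (det n Ab)) (unimodular⇒absSq[det]≡1 (proj₁ (eliminate k m A))) ⟨
    absSq (det n U) *R absSq (det n Ab)         ≡⟨ absSq-* _ _ ⟨
    absSq (det n U *R det n Ab)                 ≡⟨ cong absSq det[U]*det[Ab] ⟩
    absSq (det k H *R disc m b₀)                ≡⟨ absSq-* _ _ ⟩
    absSq (det k H) *R absSq (disc m b₀)        ≡⟨ cong (λ x → absSq (det k H) *R (x *R disc m b₀)) (conj-disc m b₀) ⟩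
    absSq (det k H) *R (disc m b₀ *R disc m b₀) ≡⟨ *R-assoc _ _ _ ⟨
    absSq (det k H) *R disc m b₀ *R disc m b₀   ∎)

  det[H]≢0 : det k H ≢ 0R
  det[H]≢0 det[H]≡0 = λᵏ≢0 (trans λᵏ≡absSq[det[H]]*disc
    (trans (cong (λ x → conj x *R x *R disc m b₀) det[H]≡0)
           (trans (cong (λ x → x *R 0R *R disc m b₀) conj-0R)
                  (solve 1 (λ d → con (+ 0) :* con (+ 0) :* d := con (+ 0)) refl (disc m b₀)))))

  -- Coordinates with respect to the columns of Uᴴ, the last m of which are b₀: w = Uᴴ y.
  y : Vector c n → Fin n → R c
  y w = U⁻¹ ᴴ ·ᵥ w

  y-top≡0 : ∀ w → InΛ n k A w → ∀ r → y w (r ↑ˡ m) ≡ 0R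
  y-top≡0 w w∈Λ r = fromInj₁ (λ det[H̄]≡0 → ⊥-elim (det[H]≢0 (conj≡0 det[H̄]≡0)))
    (x*y≡0⇒x≡0∨y≡0 (z r) (det k (conjugate H)) (left-kernel⇒*det≡0 k (conjugate H) z z·H̄≡0 r))
    where
    z : Fin k → R c
    z r = y w (r ↑ˡ m)
    conj≡0 : det k (conjugate H) ≡ 0R → det k H ≡ 0R
    conj≡0 e = trans (sym (conj-involutive _)) (trans (cong conj (trans (conj-det k H) e)) conj-0R)
    z·H̄≡0 : ∀ j → Σ[ k ] (λ r → z r *R conj (H r j)) ≡ 0R
    z·H̄≡0 j = sym (begin
      0R                                                            ≡⟨ w∈Λ j ⟨
      Σ[ n ] (λ i → conj (A i j) *R w i)
        ≡⟨ Σ-cong n (λ i → trans (cong (λ t → conj t *R w i) (A≋U⁻¹·H i j))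
                                 (trans (cong (_*R w i) (conj-Σ k _)) (*R-distribʳ-Σ k (w i) _))) ⟩
      Σ[ n ] (λ i → Σ[ k ] (λ r → conj (U⁻¹ i (r ↑ˡ m) *R H r j) *R w i))
        ≡⟨ Σ-comm n k _ ⟩
      Σ[ k ] (λ r → Σ[ n ] (λ i → conj (U⁻¹ i (r ↑ˡ m) *R H r j) *R w i))
        ≡⟨ Σ-cong k (λ r → trans (Σ-cong n (λ i → trans (cong (_*R w i) (conj-* _ _))
              (solve 3 (λ a b x → (a :* b) :* x := (a :* x) :* b) refl (conj (U⁻¹ i (r ↑ˡ m))) (conj (H r j)) (w i))))
              (sym (*R-distribʳ-Σ n (conj (H r j)) _))) ⟩
      Σ[ k ] (λ r → z r *R conj (H r j))                            ∎)

  b₀-spans : ∀ w → InΛ n k A w → Σ (Fin m → R c) (λ x → ∀ i → w i ≡ lincomb m x b₀ i)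
  b₀-spans w w∈Λ = (λ l → y w (k ↑ʳ l)) , λ i → begin
    w i                                   ≡⟨ ᴴ-inverse-·ᵥ U U⁻¹ U⁻¹·U w i ⟨
    Σ[ n ] (λ r → conj (U r i) *R y w r)  ≡⟨ Σ-splitAt k m _ ⟩
    Σ[ k ] (λ r → conj (U (r ↑ˡ m) i) *R y w (r ↑ˡ m)) +R Σ[ m ] (λ l → conj (U (k ↑ʳ l) i) *R y w (k ↑ʳ l))
      ≡⟨ cong (_+R Σ[ m ] (λ l → conj (U (k ↑ʳ l) i) *R y w (k ↑ʳ l)))
              (Σ-zero k (λ r → trans (cong (conj (U (r ↑ˡ m) i) *R_) (y-top≡0 w w∈Λ r)) (*R-zeroʳ _))) ⟩
    0R +R Σ[ m ] (λ l → conj (U (k ↑ʳ l) i) *R y w (k ↑ʳ l))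
      ≡⟨ +R-identityˡ _ ⟩
    Σ[ m ] (λ l → conj (U (k ↑ʳ l) i) *R y w (k ↑ʳ l))
      ≡⟨ Σ-cong m (λ l → *R-comm _ _) ⟩
    lincomb m (λ l → y w (k ↑ʳ l)) b₀ i   ∎

  y[lincomb] : ∀ x l' → y (lincomb m x b₀) (k ↑ʳ l') ≡ x l'
  y[lincomb] x l' = begin
    Σ[ n ] (λ i → conj (U⁻¹ i (k ↑ʳ l')) *R Σ[ m ] (λ l → x l *R b₀ l i))
      ≡⟨ Σ-cong n (λ i → *R-distribˡ-Σ m _ _) ⟩
    Σ[ n ] (λ i → Σ[ m ] (λ l → conj (U⁻¹ i (k ↑ʳ l')) *R (x l *R b₀ l i)))
      ≡⟨ Σ-comm n m _ ⟩
    Σ[ m ] (λ l → Σ[ n ] (λ i → conj (U⁻¹ i (k ↑ʳ l')) *R (x l *R b₀ l i)))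
      ≡⟨ Σ-cong m (λ l → trans (Σ-cong n (λ i → trans
           (solve 3 (λ a x b → a :* (x :* b) := x :* (b :* a)) refl (conj (U⁻¹ i (k ↑ʳ l'))) (x l) (b₀ l i))
           (cong (x l *R_) (sym (conj-* _ _)))))
           (sym (*R-distribˡ-Σ n (x l) _))) ⟩
    Σ[ m ] (λ l → x l *R Σ[ n ] (λ i → conj (U (k ↑ʳ l) i *R U⁻¹ i (k ↑ʳ l'))))
      ≡⟨ Σ-cong m (λ l → cong (x l *R_) (trans (sym (conj-Σ n _))
           (trans (cong conj (U·U⁻¹ (k ↑ʳ l) (k ↑ʳ l'))) (trans (conj-δ (k ↑ʳ l) (k ↑ʳ l')) (δ-↑ʳ k l l'))))) ⟩
    Σ[ m ] (λ l → x l *R δ l l')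
      ≡⟨ Σ-δʳ m l' x ⟩
    x l' ∎

  b₀-independent : ∀ x x' → (∀ i → lincomb m x b₀ i ≡ lincomb m x' b₀ i) → ∀ l → x l ≡ x' l
  b₀-independent x x' same l =
    trans (sym (y[lincomb] x l)) (trans (Σ-cong n (λ i → cong (conj (U⁻¹ i (k ↑ʳ l)) *R_) (same i))) (y[lincomb] x' l))

  b₀-basis : IsFreeBasisOfΛ n k A m b₀
  b₀-basis = b₀∈Λ , b₀-spans , b₀-independent

  -- det H is itself a k-th determinantal divisor, so g and det H are associates.
  absSq[g]≡absSq[det[H]] : ∀ g → IsDetDivisor n k A g → absSq g ≡ absSq (det k H)
  absSq[g]≡absSq[det[H]] g g-divisor@(_ , g-greatest) = associates⇒absSq≡ (det k H) g det[H]≢0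
    (g-greatest (det k H) (λ s _ → det-∣-minor[W·H] (λ i r → U⁻¹ i (r ↑ˡ m)) H A A≋U⁻¹·H s))
    (detDivisor-∣-det[C·A] A g g-divisor (λ i r → U (i ↑ˡ m) r))

  disc*absSq[g]≡λᵏ : ∀ b → IsFreeBasisOfΛ n k A m b → ∀ g → IsDetDivisor n k A g → disc m b *R absSq g ≡ λᵏ
  disc*absSq[g]≡λᵏ b b-basis g g-divisor = begin
    disc m b *R absSq g           ≡⟨ cong₂ _*R_ (disc-basis-invariant A m b b₀ b-basis b₀-basis) (absSq[g]≡absSq[det[H]] g g-divisor) ⟩
    disc m b₀ *R absSq (det k H)  ≡⟨ *R-comm _ _ ⟩
    absSq (det k H) *R disc m b₀  ≡⟨ λᵏ≡absSq[det[H]]*disc ⟨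
    λᵏ                            ∎

wide-icube-impossible : ∀ {c n k} (A : Matrix c n k) (λ₀ : ℕ) → λ₀ ≢ 0 → IsIcube n k A λ₀ → n ℕ.< k → ⊥
wide-icube-impossible {n = n} {k} A λ₀ λ₀≢0 icube n<k =
  ι-≢0R (λ₀ ^ k) (^-≢0 λ₀ k λ₀≢0) (trans (sym det[Aᴴ·A]≡λᵏ) det[Aᴴ·A]≡0)
  where
  det[Aᴴ·A]≡λᵏ : det k (A ᴴ · A) ≡ ι (+ (λ₀ ^ k))
  det[Aᴴ·A]≡λᵏ = det-scalar k (A ᴴ · A) λ₀ (icube⇒gram≋λδ A λ₀ icube)
  repeated-row : ∀ (f : Fin k → Fin n) → det k (A ∘ f) ≡ 0R
  repeated-row f with Finₚ.pigeonhole n<k f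
  ... | i , j , i<j , fi≡fj = det-alternating k (A ∘ f) i j (Finₚ.<⇒≢ i<j) (λ s → cong (λ t → A t s) fi≡fj)
  det[Aᴴ·A]≡0 : det k (A ᴴ · A) ≡ 0R
  det[Aᴴ·A]≡0 = multilinear-∈ ≡0R-isIdeal k (det-extensional k) (det-multilinear k) A repeated-row (A ᴴ)

Conclusion : (c : Case) (n k : ℕ) (A : Matrix c n k) (λ₀ : ℕ) → ℕ → Set
Conclusion c n k A λ₀ m =
  Σ (Basis c n m) (λ b → IsFreeBasisOfΛ n k A m b)
  × (∀ b → IsFreeBasisOfΛ n k A m b → ∀ g → IsDetDivisor n k A g → disc m b *R absSq g ≡ ι (+ (λ₀ ^ k)))

icube-conclusion : ∀ {c} k m (A : Matrix c (k ℕ.+ m) k) (λ₀ : ℕ) → λ₀ ≢ 0 → IsIcube (k ℕ.+ m) k A λ₀ →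
  Conclusion c (k ℕ.+ m) k A λ₀ m
icube-conclusion k m A λ₀ λ₀≢0 icube = (b₀ , b₀-basis) , disc*absSq[g]≡λᵏ
  where open IcubeLattice k m A λ₀ λ₀≢0 icube

mainTheorem16 : (c : Case) (n k : ℕ) (A : Matrix c n k) (λ₀ : ℕ) → NonZero λ₀ →
    IsIcube n k A λ₀ →
    Σ (Basis c n (n ∸ k)) (λ b → IsFreeBasisOfΛ n k A (n ∸ k) b)
    × (∀ b → IsFreeBasisOfΛ n k A (n ∸ k) b → ∀ g → IsDetDivisor n k A g →
         disc (n ∸ k) b *R absSq g ≡ ι (+ (λ₀ ^ k)))
mainTheorem16 c n k A λ₀ λ₀-nonZero icube with k ℕ.≤? n
... | no k≰n = ⊥-elim (wide-icube-impossible A λ₀ (ℕ.≢-nonZero⁻¹ λ₀ {{λ₀-nonZero}}) icube (ℕₚ.≰⇒> k≰n))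
... | yes k≤n with ℕₚ.m≤n⇒∃[o]m+o≡n k≤n
...   | m , refl = subst (Conclusion c (k ℕ.+ m) k A λ₀) (sym (ℕₚ.m+n∸m≡n k m))
                     (icube-conclusion k m A λ₀ (ℕ.≢-nonZero⁻¹ λ₀ {{λ₀-nonZero}}) icube)
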